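{- For every integer $n\geq 1$ there is a constant $C_n$ such that for every odd prime power $q$ there exists a Kakeya set $K\subseteq\mathbb{F}_q^n$ with \[ \Bigl|\,|K|-2^{ -n+1}q^n\Bigl(1+\frac{n+1-2^{ -n+2}}{q}\Bigr)\Bigr|\leq C_n\, 2^{ -n+1}q^{n-2}. \]
   Context: A set $K\subseteq\mathbb{F}_q^n$ is a Kakeya set if for every $b\in\mathbb{F}_q^n\setminus\{0\}$ there exists $a\in\mathbb{F}_q^n$ such that $\{a+bt: t\in\mathbb{F}_q\}\subseteq K$. -}

module Defs where

open import Level using (0ℓ)
open import Data.Bool using (Bool; true; false)
open import Data.Nat as ℕ using (ℕ; zero; suc; _∸_; NonZero)
open import Data.Nat.Properties using (m^n≢0)
open import Data.Nat.Divisibility using (_∣_)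
open import Data.Integer using (+_)
open import Data.Rational as ℚ using (ℚ)
open import Data.Fin using (Fin)
open import Data.Vec using (Vec; []; _∷_; replicate; zipWith; map)
open import Data.List as List using (List; allFin; concatMap; length)
open import Data.Product using (∃; Σ; _×_; _,_)
open import Function.Bundles using (_↔_; Inverse)
open import Relation.Nullary using (¬_)
open import Relation.Binary.PropositionalEquality using (_≡_; _≢_)
open import Algebra.Structures using (IsCommutativeRing)

record FiniteField : Set₁ where
  field
    Carrier : Set
    _+_ _*_ : Carrier → Carrier → Carrier
    -_      : Carrier → Carrier
    0# 1#   : Carrier
    isCommutativeRing : IsCommutativeRing _≡_ _+_ _*_ -_ 0# 1#
    0≢1     : 0# ≢ 1#
    inverse : ∀ x → x ≢ 0# → ∃ λ y → x * y ≡ 1#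
    size    : ℕ
    enum    : Fin size ↔ Carrier

module _ (F : FiniteField) where
  open FiniteField F

  Point : ℕ → Set
  Point n = Vec Carrier n

  zeroPt : ∀ n → Point n
  zeroPt n = replicate n 0#

  linePt : ∀ {n} → Point n → Point n → Carrier → Point n
  linePt a b t = zipWith (λ ai bi → ai + (bi * t)) a b

  IsKakeya : ∀ n → (Point n → Bool) → Set
  IsKakeya n K = ∀ (b : Point n) → b ≢ zeroPt n →
                 ∃ λ (a : Point n) → ∀ (t : Carrier) → K (linePt a b t) ≡ true

  elems : List Carrier
  elems = List.map (Inverse.to enum) (allFin size)

  -- list of all points of F^n, each occurring exactly once
  allPts : ∀ n → List (Point n)
  allPts zero = [] List.∷ List.[]
  allPts (suc n) = concatMap (λ x → List.map (x ∷_) (allPts n)) elems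

  countTrue : ∀ {n} → (Point n → Bool) → List (Point n) → ℕ
  countTrue K List.[] = 0
  countTrue K (p List.∷ ps) with K p
  ... | true  = suc (countTrue K ps)
  ... | false = countTrue K ps

  card : ∀ n → (Point n → Bool) → ℕ
  card n K = countTrue K (allPts n)

ℕtoℚ : ℕ → ℚ
ℕtoℚ m = + m ℚ./ 1

inv2^ : ℕ → ℚ
inv2^ k = (+ 1 ℚ./ (2 ℕ.^ k)) {{m^n≢0 2 k}}

invℕ : (m : ℕ) → .{{NonZero m}} → ℚ
invℕ m = + 1 ℚ./ m

odd⇒nonZero : ∀ q → ¬ (2 ∣ q) → NonZero q
odd⇒nonZero zero odd with odd (Data.Nat.Divisibility._∣0 2)
  where import Data.Nat.Divisibility
... | ()
odd⇒nonZero (suc q) odd = _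

-- main term  2^{-n+1} q^n (1 + (n+1-2^{-n+2})/q)   (for n ≥ 1)
mainTerm : (n q : ℕ) → .{{NonZero q}} → ℚ
mainTerm n q = inv2^ (n ∸ 1) ℚ.* ℕtoℚ (q ℕ.^ n)
  ℚ.* (ℚ.1ℚ ℚ.+ (ℕtoℚ (suc n) ℚ.- ℕtoℚ 4 ℚ.* inv2^ n) ℚ.* invℕ q)

-- error scale  2^{-n+1} q^{n-2}  = 2^{-n+1} q^n / q^2   (for n ≥ 1)
errTerm : (n q : ℕ) → .{{NonZero q}} → ℚ
errTerm n q = inv2^ (n ∸ 1) ℚ.* ℕtoℚ (q ℕ.^ n) ℚ.* invℕ q ℚ.* invℕ q

-- The set is built recursively: K₀ = F, and K_{m+1} ⊆ F × F^{m+1} is the union of the points (t, x)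
-- for which every xᵢ + t² is a square and of {0} × K_m. A direction (β, b) with β ≠ 0 is covered in the
-- first piece by the line through (0, (bᵢ/2β)²), because along it xᵢ + (βt)² = (βt + bᵢ/2β)²;
-- a direction (0, b) is covered in {0} × K_m.
--
-- For the size, inclusion–exclusion gives |K_{m+1}| = q s^{m+1} + |K_m| - |overlap|, with s = (q + 1)/2
-- squares in F. The overlap is counted through the number N(d) of v with v and v + d both squares, which
-- for d ≠ 0 is q/4 + O(1) because b² - a² = d has exactly q - 1 solutions. Tracking the errors as
-- O(q^k) uniformly in q, induction on m gives 4^m q |K_m| = 2^m q^{m+2} + (2^m (m+2) - 2) q^{m+1} + O(q^m),
-- which is the claim for n = m + 1 after dividing by 4^m q.

module Submission where

open import Defs
open import Data.Bool using (Bool; true; false; _∧_; _∨_; not)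
import Data.Bool.Properties as Bool
open import Data.Nat as ℕ using (ℕ; zero; suc; NonZero; s≤s; z≤n)
import Data.Nat.Properties as ℕ
import Data.Nat.Tactic.RingSolver as ℕ-Solver
open import Data.Nat.Divisibility using (_∣_; divides)
open import Data.Integer as ℤ using (ℤ)
import Data.Integer.Properties as ℤ
import Data.Integer.Tactic.RingSolver as ℤ-Solver
open import Data.Rational as ℚ using (ℚ; 0ℚ; 1ℚ)
import Data.Rational.Properties as ℚ
open import Data.Rational.Solver using (module +-*-Solver)
open import Data.Rational.Unnormalised as ℚᵘ using (mkℚᵘ; *≡*; *≤*)
import Data.Rational.Unnormalised.Properties as ℚᵘ
open import Data.Fin as Fin using (Fin)
import Data.Fin.Properties as Fin
import Data.Fin.Permutation as Perm
open import Data.List as List using (List; []; _∷_; _++_; concatMap; tabulate)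
open import Data.Vec using (Vec; []; _∷_; map)
open import Data.Vec.Functional using (Vector)
open import Data.Maybe using (nothing)
open import Data.Empty using (⊥-elim)
open import Data.Product using (Σ; ∃; _×_; _,_; proj₁; proj₂)
open import Data.Sum using (_⊎_; inj₁; inj₂; [_,_]′)
open import Function using (_∘_; id)
open import Function.Bundles using (_↔_; Inverse; mk↔ₛ′)
open import Function.Properties.Inverse using (↔⇒↣; ↔-sym)
open import Algebra.Bundles using (CommutativeRing)
import Algebra.Properties.Ring as RingProperties
import Algebra.Solver.Ring.NaturalCoefficients as NaturalCoefficientsSolver
open import Algebra.Properties.Semiring.Sum ℕ.+-*-semiring
  using (sum; sum-cong-≗; ∑-distrib-+; ∑-comm; sum-permute; *-distribˡ-sum; *-distribʳ-sum)
open import Algebra.Properties.CommutativeSemigroup ℕ.*-commutativeSemigroup using (x∙yz≈y∙xz)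
open import Relation.Binary using (tri<; tri≈; tri>)
open import Relation.Binary.Bundles using (Setoid)
open import Relation.Binary.Definitions using (DecidableEquality)
import Relation.Binary.Reasoning.Setoid as SetoidReasoning
open import Relation.Binary.PropositionalEquality
open import Relation.Nullary using (¬_; Dec; yes; no; does)
open import Relation.Nullary.Decidable using (map′; dec-true; dec-false)


module _ where

  open import Data.Nat using (_+_; _*_; _≤_)

  𝟙 : Bool → ℕ
  𝟙 true = 1
  𝟙 false = 0

  𝟙≤1 : ∀ b → 𝟙 b ≤ 1
  𝟙≤1 true = ℕ.≤-refl
  𝟙≤1 false = ℕ.z≤n

  𝟙-∧ : ∀ a b → 𝟙 (a ∧ b) ≡ 𝟙 a * 𝟙 b
  𝟙-∧ true b = sym (ℕ.+-identityʳ (𝟙 b))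
  𝟙-∧ false b = refl

  sum-const : ∀ n c → sum {n} (λ _ → c) ≡ n * c
  sum-const zero c = refl
  sum-const (suc n) c = cong (c +_) (sum-const n c)

  sum-mono-≤ : ∀ {n} {f g : Vector ℕ n} → (∀ i → f i ≤ g i) → sum f ≤ sum g
  sum-mono-≤ {zero} f≤g = ℕ.z≤n
  sum-mono-≤ {suc n} f≤g = ℕ.+-mono-≤ (f≤g Fin.zero) (sum-mono-≤ (f≤g ∘ Fin.suc))

  sum-indicator : ∀ {n} (j : Fin n) → sum (λ i → 𝟙 (does (i Fin.≟ j))) ≡ 1
  sum-indicator {suc n} Fin.zero = cong suc (trans (sum-const n 0) (ℕ.*-zeroʳ n))
  sum-indicator {suc n} (Fin.suc j) = sum-indicator j

  module FiniteSum {A : Set} {n : ℕ} (enum : Fin n ↔ A) where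

    open Inverse enum using (to; from) renaming (strictlyInverseˡ to to-from; strictlyInverseʳ to from-to)

    ∑ : (A → ℕ) → ℕ
    ∑ f = sum (f ∘ to)

    ∑-cong : ∀ {f g : A → ℕ} → (∀ x → f x ≡ g x) → ∑ f ≡ ∑ g
    ∑-cong f≗g = sum-cong-≗ (f≗g ∘ to)

    ∑-+ : ∀ (f g : A → ℕ) → ∑ (λ x → f x + g x) ≡ ∑ f + ∑ g
    ∑-+ f g = ∑-distrib-+ (f ∘ to) (g ∘ to)

    *-distribˡ-∑ : ∀ c (f : A → ℕ) → c * ∑ f ≡ ∑ (λ x → c * f x)
    *-distribˡ-∑ c f = *-distribˡ-sum c (f ∘ to)

    *-distribʳ-∑ : ∀ c (f : A → ℕ) → ∑ f * c ≡ ∑ (λ x → f x * c)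
    *-distribʳ-∑ c f = *-distribʳ-sum c (f ∘ to)

    ∑-const : ∀ c → ∑ (λ _ → c) ≡ n * c
    ∑-const = sum-const n

    ∑-swap : ∀ (f : A → A → ℕ) → ∑ (λ x → ∑ (f x)) ≡ ∑ (λ y → ∑ (λ x → f x y))
    ∑-swap f = ∑-comm (λ i j → f (to i) (to j))

    ∑-mono-≤ : ∀ {f g : A → ℕ} → (∀ x → f x ≤ g x) → ∑ f ≤ ∑ g
    ∑-mono-≤ f≤g = sum-mono-≤ (f≤g ∘ to)

    ∑-reindex : ∀ (σ : A ↔ A) (f : A → ℕ) → ∑ f ≡ ∑ (f ∘ Inverse.to σ)
    ∑-reindex σ f = trans (sum-permute (f ∘ to) π) (sum-cong-≗ (λ i → cong f (to-from (Inverse.to σ (to i)))))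
      where
      π : Perm.Permutation n n
      π = Perm.permutation (from ∘ Inverse.to σ ∘ to) (from ∘ Inverse.from σ ∘ to)
            (λ i → trans (cong (from ∘ Inverse.to σ) (to-from _))
                     (trans (cong from (Inverse.strictlyInverseˡ σ _)) (from-to i)))
            (λ i → trans (cong (from ∘ Inverse.from σ) (to-from _))
                     (trans (cong from (Inverse.strictlyInverseʳ σ _)) (from-to i)))

    infix 4 _≟_
    _≟_ : DecidableEquality A
    _≟_ = Fin.inj⇒≟ (↔⇒↣ (↔-sym enum))

    δ : A → A → ℕ
    δ x y = 𝟙 (does (x ≟ y))

    δ-≡ : ∀ {x y} → x ≡ y → δ x y ≡ 1
    δ-≡ {x} {y} x≡y = cong 𝟙 (dec-true (x ≟ y) x≡y)

    δ-≢ : ∀ {x y} → x ≢ y → δ x y ≡ 0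
    δ-≢ {x} {y} x≢y = cong 𝟙 (dec-false (x ≟ y) x≢y)

    δ-sym : ∀ x y → δ x y ≡ δ y x
    δ-sym x y with x ≟ y
    ... | yes x≡y = trans (δ-≡ x≡y) (sym (δ-≡ (sym x≡y)))
    ... | no x≢y = trans (δ-≢ x≢y) (sym (δ-≢ (x≢y ∘ sym)))

    ∑-δ-1 : ∀ c → ∑ (λ x → δ x c) ≡ 1
    ∑-δ-1 c = trans (sum-cong-≗ (λ i → cong (λ j → 𝟙 (does (j Fin.≟ from c))) (from-to i)))
                    (sum-indicator (from c))

    ∑-δ : ∀ c (f : A → ℕ) → ∑ (λ x → δ x c * f x) ≡ f c
    ∑-δ c f = begin
      ∑ (λ x → δ x c * f x) ≡⟨ ∑-cong pointwise ⟩
      ∑ (λ x → δ x c * f c) ≡⟨ *-distribʳ-∑ (f c) (λ x → δ x c) ⟨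
      ∑ (λ x → δ x c) * f c ≡⟨ cong (_* f c) (∑-δ-1 c) ⟩
      1 * f c               ≡⟨ ℕ.*-identityˡ (f c) ⟩
      f c                   ∎
      where
      open ≡-Reasoning
      pointwise : ∀ x → δ x c * f x ≡ δ x c * f c
      pointwise x with x ≟ c
      ... | yes refl = refl
      ... | no x≢c = trans (cong (_* f x) (δ-≢ x≢c)) (sym (cong (_* f c) (δ-≢ x≢c)))

    ∑-preimage : ∀ (f : A → A) (h : A → ℕ) → ∑ (λ v → ∑ (λ a → δ (f a) v) * h v) ≡ ∑ (h ∘ f)
    ∑-preimage f h = begin
      ∑ (λ v → ∑ (λ a → δ (f a) v) * h v)  ≡⟨ ∑-cong (λ v → *-distribʳ-∑ (h v) (λ a → δ (f a) v)) ⟩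
      ∑ (λ v → ∑ (λ a → δ (f a) v * h v))  ≡⟨ ∑-swap (λ v a → δ (f a) v * h v) ⟩
      ∑ (λ a → ∑ (λ v → δ (f a) v * h v))  ≡⟨ ∑-cong (λ a → trans (∑-cong (λ v → cong (_* h v) (δ-sym (f a) v))) (∑-δ (f a) h)) ⟩
      ∑ (h ∘ f)                            ∎
      where open ≡-Reasoning

    -- Each orbit {x, σ x} has exactly one element whose index is below its partner's.
    involution⇒even : (σ : A → A) → (∀ x → σ (σ x) ≡ x) → (∀ x → σ x ≢ x) → 2 ∣ n
    involution⇒even σ σ²≡id σx≢x = divides (∑ first) (begin
      n                                ≡⟨ ℕ.*-identityʳ n ⟨
      n * 1                            ≡⟨ ∑-const 1 ⟨
      ∑ (λ _ → 1)                      ≡⟨ ∑-cong one-of-pair ⟩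
      ∑ (λ x → first x + first (σ x))  ≡⟨ ∑-+ first (first ∘ σ) ⟩
      ∑ first + ∑ (first ∘ σ)          ≡⟨ cong (∑ first +_) (∑-reindex σ↔ first) ⟨
      ∑ first + ∑ first                ≡⟨ cong (∑ first +_) (ℕ.+-identityʳ (∑ first)) ⟨
      2 * ∑ first                      ≡⟨ ℕ.*-comm 2 (∑ first) ⟩
      ∑ first * 2                      ∎)
      where
      open ≡-Reasoning
      σ↔ : A ↔ A
      σ↔ = mk↔ₛ′ σ σ σ²≡id σ²≡id
      first : A → ℕ
      first x = 𝟙 (does (from x Fin.<? from (σ x)))
      one-of-pair : ∀ x → 1 ≡ first x + first (σ x)
      one-of-pair x rewrite σ²≡id x with Fin.<-cmp (from x) (from (σ x))
      ... | tri< i<j _ j≮i = sym (cong₂ _+_ (cong 𝟙 (dec-true (_ Fin.<? _) i<j)) (cong 𝟙 (dec-false (_ Fin.<? _) j≮i)))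
      ... | tri≈ _ i≡j _ = ⊥-elim (σx≢x x (sym (trans (sym (to-from x)) (trans (cong to i≡j) (to-from (σ x))))))
      ... | tri> i≮j _ j<i = sym (cong₂ _+_ (cong 𝟙 (dec-false (_ Fin.<? _) i≮j)) (cong 𝟙 (dec-true (_ Fin.<? _) j<i)))

module FieldProperties (F : FiniteField) where

  open FiniteField F using (Carrier; isCommutativeRing; 0≢1; inverse; size; enum)

  commutativeRing : CommutativeRing _ _
  commutativeRing = record { isCommutativeRing = isCommutativeRing }

  open CommutativeRing commutativeRing public
    using (_+_; _*_; -_; 0#; 1#; +-assoc; +-comm; +-identityˡ; +-identityʳ; -‿inverseˡ; -‿inverseʳ;
           *-assoc; *-comm; *-identityˡ; *-identityʳ; zeroˡ; zeroʳ; distribʳ)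
  open RingProperties (CommutativeRing.ring commutativeRing) public
    using (-‿distribˡ-*; -‿distribʳ-*; -‿involutive; +-cancelˡ) renaming (x∙y⁻¹≈ε⇒x≈y to x-y≈0⇒x≈y)
  open NaturalCoefficientsSolver (CommutativeRing.commutativeSemiring commutativeRing) (λ _ _ → nothing)
    public using (solve; _:=_; _:+_; _:*_; con)
  open FiniteSum enum public
  open ≡-Reasoning

  two : Carrier
  two = 1# + 1#

  *-zero-product : ∀ x y → x * y ≡ 0# → x ≡ 0# ⊎ y ≡ 0#
  *-zero-product x y xy≡0 with x ≟ 0#
  ... | yes x≡0 = inj₁ x≡0
  ... | no x≢0 with inverse x x≢0
  ... | x⁻¹ , xx⁻¹≡1 = inj₂ (begin
    y              ≡⟨ *-identityˡ y ⟨
    1# * y         ≡⟨ cong (_* y) (trans (sym xx⁻¹≡1) (*-comm x x⁻¹)) ⟩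
    (x⁻¹ * x) * y  ≡⟨ *-assoc x⁻¹ x y ⟩
    x⁻¹ * (x * y)  ≡⟨ cong (x⁻¹ *_) xy≡0 ⟩
    x⁻¹ * 0#       ≡⟨ zeroʳ x⁻¹ ⟩
    0#             ∎)

  *-nonzero : ∀ {x y} → x ≢ 0# → y ≢ 0# → x * y ≢ 0#
  *-nonzero {x} {y} x≢0 y≢0 xy≡0 with *-zero-product x y xy≡0
  ... | inj₁ x≡0 = x≢0 x≡0
  ... | inj₂ y≡0 = y≢0 y≡0

  -a*-a≡a*a : ∀ a → - a * - a ≡ a * a
  -a*-a≡a*a a = begin
    - a * - a      ≡⟨ -‿distribˡ-* a (- a) ⟨
    - (a * - a)    ≡⟨ cong -_ (-‿distribʳ-* a a) ⟨
    - (- (a * a))  ≡⟨ -‿involutive (a * a) ⟩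
    a * a          ∎

  square-roots : ∀ a b → a * a ≡ b * b → a ≡ b ⊎ a ≡ - b
  square-roots a b a²≡b² with *-zero-product (a + - b) (a + b) difference-of-squares
    where
    difference-of-squares : (a + - b) * (a + b) ≡ 0#
    difference-of-squares = begin
      (a + - b) * (a + b)
        ≡⟨ solve 3 (λ a b b′ → (a :+ b′) :* (a :+ b) := a :* a :+ b′ :* b :+ a :* (b :+ b′)) refl a b (- b) ⟩
      a * a + - b * b + a * (b + - b)  ≡⟨ cong₂ (λ u v → u + - b * b + a * v) a²≡b² (-‿inverseʳ b) ⟩
      b * b + - b * b + a * 0#         ≡⟨ cong₂ _+_ (distribʳ b b (- b)) (sym (zeroʳ a)) ⟨
      (b + - b) * b + 0#               ≡⟨ cong (λ u → u * b + 0#) (-‿inverseʳ b) ⟩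
      0# * b + 0#                      ≡⟨ trans (+-identityʳ _) (zeroˡ b) ⟩
      0#                               ∎
  ... | inj₁ a-b≡0 = inj₁ (x-y≈0⇒x≈y a b a-b≡0)
  ... | inj₂ a+b≡0 = inj₂ (x-y≈0⇒x≈y a (- b) (trans (cong (a +_) (-‿involutive b)) a+b≡0))

  ∑-translate : ∀ c (f : Carrier → ℕ) → ∑ f ≡ ∑ (λ x → f (x + c))
  ∑-translate c = ∑-reindex (mk↔ₛ′ (_+ c) (_+ - c) (λ x → cancel (- c) c x (-‿inverseʳ c)) (λ x → cancel c (- c) x (-‿inverseˡ c)))
    where
    cancel : ∀ u v x → v + u ≡ 0# → x + u + v ≡ x
    cancel u v x v+u≡0 = trans (+-assoc x u v) (trans (cong (x +_) (trans (+-comm u v) v+u≡0)) (+-identityʳ x))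

  ∑-dilate : ∀ {u} → u ≢ 0# → ∀ (f : Carrier → ℕ) → ∑ f ≡ ∑ (λ x → f (u * x))
  ∑-dilate {u} u≢0 with inverse u u≢0
  ... | u⁻¹ , uu⁻¹≡1 = ∑-reindex (mk↔ₛ′ (u *_) (u⁻¹ *_) (cancel u u⁻¹ uu⁻¹≡1) (cancel u⁻¹ u (trans (*-comm u⁻¹ u) uu⁻¹≡1)))
    where
    cancel : ∀ v w → v * w ≡ 1# → ∀ x → v * (w * x) ≡ x
    cancel v w vw≡1 x = trans (sym (*-assoc v w x)) (trans (cong (_* x) vw≡1) (*-identityˡ x))

  δ-cancelˡ : ∀ u x y → δ (u + x) (u + y) ≡ δ x y
  δ-cancelˡ u x y with x ≟ y
  ... | yes x≡y = trans (δ-≡ (cong (u +_) x≡y)) (sym (δ-≡ x≡y))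
  ... | no x≢y = trans (δ-≢ (x≢y ∘ +-cancelˡ u x y)) (sym (δ-≢ x≢y))

  -- In characteristic 2, x ↦ x + 1 pairs up the elements of F.
  two≢0 : ¬ 2 ∣ size → two ≢ 0#
  two≢0 odd 2≡0 = odd (involution⇒even (_+ 1#) shift-twice shift-moves)
    where
    shift-twice : ∀ x → x + 1# + 1# ≡ x
    shift-twice x = trans (+-assoc x 1# 1#) (trans (cong (x +_) 2≡0) (+-identityʳ x))
    shift-moves : ∀ x → x + 1# ≢ x
    shift-moves x x+1≡x = 0≢1 (sym (+-cancelˡ x 1# 0# (trans x+1≡x (sym (+-identityʳ x)))))

module Counting (F : FiniteField) where

  open import Data.Nat using (_+_; _*_; _^_)
  open FieldProperties F using (∑; ∑-cong; *-distribʳ-∑)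
  open FiniteField F using (Carrier; size; enum)
  open Inverse enum using (to)

  countTrue-++ : ∀ {n} (K : Point F n → Bool) xs ys →
                 countTrue F K (xs ++ ys) ≡ countTrue F K xs + countTrue F K ys
  countTrue-++ K [] ys = refl
  countTrue-++ K (p ∷ xs) ys with K p
  ... | true = cong suc (countTrue-++ K xs ys)
  ... | false = countTrue-++ K xs ys

  countTrue-cons : ∀ {n} (K : Point F (suc n) → Bool) x (ps : List (Point F n)) →
                   countTrue F K (List.map (x ∷_) ps) ≡ countTrue F (K ∘ (x ∷_)) ps
  countTrue-cons K x [] = refl
  countTrue-cons K x (p ∷ ps) with K (x ∷ p)
  ... | true = cong suc (countTrue-cons K x ps)
  ... | false = countTrue-cons K x ps

  countTrue-concat : ∀ {n m} (K : Point F n → Bool) (H : Carrier → List (Point F n)) (f : Fin m → Fin size) →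
    countTrue F K (concatMap H (List.map to (tabulate f))) ≡ sum (λ i → countTrue F K (H (to (f i))))
  countTrue-concat {m = zero} K H f = refl
  countTrue-concat {m = suc m} K H f = trans (countTrue-++ K (H (to (f Fin.zero))) _)
    (cong (countTrue F K (H (to (f Fin.zero))) +_) (countTrue-concat K H (f ∘ Fin.suc)))

  card-cons : ∀ n (K : Point F (suc n) → Bool) → card F (suc n) K ≡ ∑ (λ x → card F n (K ∘ (x ∷_)))
  card-cons n K = trans (countTrue-concat K (λ x → List.map (x ∷_) (allPts F n)) id)
                        (sum-cong-≗ (λ i → countTrue-cons K (to i) (allPts F n)))

  card-cong : ∀ n {K K′ : Point F n → Bool} → (∀ p → K p ≡ K′ p) → card F n K ≡ card F n K′
  card-cong n {K} {K′} K≗K′ = go (allPts F n)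
    where
    go : ∀ ps → countTrue F K ps ≡ countTrue F K′ ps
    go [] = refl
    go (p ∷ ps) with K p | K′ p | K≗K′ p
    ... | true | true | refl = cong suc (go ps)
    ... | false | false | refl = go ps

  card-∨ : ∀ n (A B : Point F n → Bool) →
           card F n (λ p → A p ∨ B p) + card F n (λ p → A p ∧ B p) ≡ card F n A + card F n B
  card-∨ n A B = go (allPts F n)
    where
    count : (Point F n → Bool) → List (Point F n) → ℕ
    count = countTrue F
    go : ∀ ps → count (λ p → A p ∨ B p) ps + count (λ p → A p ∧ B p) ps ≡ count A ps + count B ps
    go [] = refl
    go (p ∷ ps) with A p | B p
    ... | true | true = cong suc (trans (ℕ.+-suc (count _ ps) (count _ ps))
                          (trans (cong suc (go ps)) (sym (ℕ.+-suc (count A ps) (count B ps)))))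
    ... | true | false = cong suc (go ps)
    ... | false | true = trans (cong suc (go ps)) (sym (ℕ.+-suc (count A ps) (count B ps)))
    ... | false | false = go ps

  card-guard : ∀ n b (K : Point F n → Bool) → card F n (λ p → b ∧ K p) ≡ 𝟙 b * card F n K
  card-guard n true K = sym (ℕ.+-identityʳ _)
  card-guard n false K = go (allPts F n)
    where
    go : ∀ ps → countTrue F (λ _ → false) ps ≡ 0
    go [] = refl
    go (p ∷ ps) = go ps

  allᵛ : ∀ {n} → (Carrier → Bool) → Vec Carrier n → Bool
  allᵛ P [] = true
  allᵛ P (x ∷ xs) = P x ∧ allᵛ P xs

  allᵛ-∧ : ∀ {n} (P Q : Carrier → Bool) (xs : Vec Carrier n) → (allᵛ P xs ∧ allᵛ Q xs) ≡ allᵛ (λ v → P v ∧ Q v) xs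
  allᵛ-∧ P Q [] = refl
  allᵛ-∧ P Q (x ∷ xs) with P x | Q x
  ... | true | true = allᵛ-∧ P Q xs
  ... | true | false = Bool.∧-zeroʳ _
  ... | false | _ = refl

  card-allᵛ : ∀ n (P : Carrier → Bool) → card F n (allᵛ P) ≡ ∑ (𝟙 ∘ P) ^ n
  card-allᵛ zero P = refl
  card-allᵛ (suc n) P = begin
    card F (suc n) (allᵛ P)                   ≡⟨ card-cons n (allᵛ P) ⟩
    ∑ (λ x → card F n (λ p → P x ∧ allᵛ P p)) ≡⟨ ∑-cong (λ x → card-guard n (P x) (allᵛ P)) ⟩
    ∑ (λ x → 𝟙 (P x) * card F n (allᵛ P))     ≡⟨ *-distribʳ-∑ _ (𝟙 ∘ P) ⟨
    ∑ (𝟙 ∘ P) * card F n (allᵛ P)             ≡⟨ cong (∑ (𝟙 ∘ P) *_) (card-allᵛ n P) ⟩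
    ∑ (𝟙 ∘ P) ^ suc n                         ∎
    where open ≡-Reasoning

module Squares (F : FiniteField) (odd : ¬ 2 ∣ FiniteField.size F) where

  open FiniteField F using (Carrier; size; enum)
  open FieldProperties F
  open Inverse enum using (to; from) renaming (strictlyInverseˡ to to-from)
  open import Data.Nat using (_≤_)
  open ℕ-Solver using (solve-∀)
  open ≡-Reasoning

  IsSquare : Carrier → Set
  IsSquare v = ∃ λ a → a * a ≡ v

  isSquare? : ∀ v → Dec (IsSquare v)
  isSquare? v = map′ (λ (i , i²≡v) → to i , i²≡v)
                     (λ (a , a²≡v) → from a , trans (cong (λ x → x * x) (to-from a)) a²≡v)
                     (Fin.any? (λ i → to i * to i ≟ v))

  isSquare : Carrier → Bool
  isSquare v = does (isSquare? v)

  square : Carrier → ℕ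
  square v = 𝟙 (isSquare v)

  square-≡1 : ∀ {v} → IsSquare v → square v ≡ 1
  square-≡1 {v} □v = cong 𝟙 (dec-true (isSquare? v) □v)

  square-≡0 : ∀ {v} → ¬ IsSquare v → square v ≡ 0
  square-≡0 {v} ¬□v = cong 𝟙 (dec-false (isSquare? v) ¬□v)

  #squares : ℕ
  #squares = ∑ square

  #roots : Carrier → ℕ
  #roots v = ∑ (λ a → δ (a * a) v)

  a≢-a : ∀ {a} → a ≢ 0# → a ≢ - a
  a≢-a {a} a≢0 a≡-a = *-nonzero (two≢0 odd) a≢0 (begin
    two * a  ≡⟨ solve 1 (λ a → con 2 :* a := a :+ a) refl a ⟩
    a + a    ≡⟨ cong (a +_) a≡-a ⟩
    a + - a  ≡⟨ -‿inverseʳ a ⟩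
    0#       ∎)

  #roots-a² : ∀ {a} → a ≢ 0# → #roots (a * a) ≡ 2
  #roots-a² {a} a≢0 = begin
    ∑ (λ b → δ (b * b) (a * a))    ≡⟨ ∑-cong roots-of-a² ⟩
    ∑ (λ b → δ b a ℕ.+ δ b (- a))  ≡⟨ ∑-+ (λ b → δ b a) (λ b → δ b (- a)) ⟩
    ∑ (λ b → δ b a) ℕ.+ ∑ (λ b → δ b (- a)) ≡⟨ cong₂ ℕ._+_ (∑-δ-1 a) (∑-δ-1 (- a)) ⟩
    2 ∎
    where
    roots-of-a² : ∀ b → δ (b * b) (a * a) ≡ δ b a ℕ.+ δ b (- a)
    roots-of-a² b with b ≟ a | b ≟ - a
    ... | yes refl | _ = trans (δ-≡ refl) (sym (cong₂ ℕ._+_ (δ-≡ refl) (δ-≢ (a≢-a a≢0))))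
    ... | no _ | yes refl = trans (δ-≡ (-a*-a≡a*a a)) (sym (cong₂ ℕ._+_ (δ-≢ (a≢-a a≢0 ∘ sym)) (δ-≡ refl)))
    ... | no b≢a | no b≢-a = sym (trans (cong₂ ℕ._+_ (δ-≢ b≢a) (δ-≢ b≢-a)) (sym (δ-≢ ([ b≢a , b≢-a ]′ ∘ square-roots b a))))

  #roots-0 : #roots 0# ≡ 1
  #roots-0 = trans (∑-cong root-of-0) (∑-δ-1 0#)
    where
    root-of-0 : ∀ a → δ (a * a) 0# ≡ δ a 0#
    root-of-0 a with a ≟ 0#
    ... | yes refl = trans (δ-≡ (zeroˡ 0#)) (sym (δ-≡ refl))
    ... | no a≢0 = trans (δ-≢ (*-nonzero a≢0 a≢0)) (sym (δ-≢ a≢0))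

  #roots-nonsquare : ∀ {v} → ¬ IsSquare v → #roots v ≡ 0
  #roots-nonsquare {v} ¬□v = trans (∑-cong (λ a → δ-≢ (λ a²≡v → ¬□v (a , a²≡v)))) (trans (∑-const 0) (ℕ.*-zeroʳ size))

  #roots+δ : ∀ v → #roots v ℕ.+ δ v 0# ≡ 2 ℕ.* square v
  #roots+δ v with isSquare? v
  ... | no ¬□v = trans (cong₂ ℕ._+_ (#roots-nonsquare ¬□v) (δ-≢ λ v≡0 → ¬□v (0# , trans (zeroˡ 0#) (sym v≡0))))
                        (cong (2 ℕ.*_) (sym (square-≡0 ¬□v)))
  ... | yes □v@(a , refl) = trans (roots a) (cong (2 ℕ.*_) (sym (square-≡1 □v)))
    where
    roots : ∀ a → #roots (a * a) ℕ.+ δ (a * a) 0# ≡ 2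
    roots a with a ≟ 0#
    ... | yes refl = cong₂ ℕ._+_ (trans (cong #roots (zeroˡ 0#)) #roots-0) (δ-≡ (zeroˡ 0#))
    ... | no a≢0 = cong₂ ℕ._+_ (#roots-a² a≢0) (δ-≢ (*-nonzero a≢0 a≢0))

  #roots≤2 : ∀ v → #roots v ≤ 2
  #roots≤2 v = ℕ.≤-trans (ℕ.m≤m+n (#roots v) (δ v 0#))
                (ℕ.≤-trans (ℕ.≤-reflexive (#roots+δ v)) (ℕ.*-monoʳ-≤ 2 (𝟙≤1 (does (isSquare? v)))))

  ∑-#roots : ∑ #roots ≡ size
  ∑-#roots = begin
    ∑ (λ v → ∑ (λ a → δ (a * a) v)) ≡⟨ ∑-swap (λ v a → δ (a * a) v) ⟩
    ∑ (λ a → ∑ (λ v → δ (a * a) v)) ≡⟨ ∑-cong (λ a → trans (∑-cong (δ-sym (a * a))) (∑-δ-1 (a * a))) ⟩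
    ∑ (λ _ → 1)                     ≡⟨ ∑-const 1 ⟩
    size ℕ.* 1                      ≡⟨ ℕ.*-identityʳ size ⟩
    size                            ∎

  2*#squares : 2 ℕ.* #squares ≡ size ℕ.+ 1
  2*#squares = begin
    2 ℕ.* ∑ square                          ≡⟨ *-distribˡ-∑ 2 square ⟩
    ∑ (λ v → 2 ℕ.* square v)                ≡⟨ ∑-cong (sym ∘ #roots+δ) ⟩
    ∑ (λ v → #roots v ℕ.+ δ v 0#)           ≡⟨ ∑-+ #roots (λ v → δ v 0#) ⟩
    ∑ #roots ℕ.+ ∑ (λ v → δ v 0#)           ≡⟨ cong₂ ℕ._+_ ∑-#roots (∑-δ-1 0#) ⟩
    size ℕ.+ 1                              ∎

  ∑-δ-affine : ∀ {u} → u ≢ 0# → ∀ c d → ∑ (λ a → δ (u * a + c) d) ≡ 1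
  ∑-δ-affine {u} u≢0 c d = begin
    ∑ (λ a → δ (u * a + c) d) ≡⟨ ∑-dilate u≢0 (λ w → δ (w + c) d) ⟨
    ∑ (λ w → δ (w + c) d)     ≡⟨ ∑-translate c (λ w → δ w d) ⟨
    ∑ (λ w → δ w d)           ≡⟨ ∑-δ-1 d ⟩
    1                         ∎

  -- Counting solutions of b² - a² = d, i.e. of b (b + 2a) = d after b ↦ b + a.
  ∑-#roots-product : ∀ {d} → d ≢ 0# → ∑ (λ v → #roots v ℕ.* #roots (v + d)) ℕ.+ 1 ≡ size
  ∑-#roots-product {d} d≢0 = begin
    ∑ (λ v → #roots v ℕ.* #roots (v + d)) ℕ.+ 1
      ≡⟨ cong (ℕ._+ 1) (∑-preimage (λ a → a * a) (λ v → #roots (v + d))) ⟩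
    ∑ (λ a → #roots (a * a + d)) ℕ.+ 1
      ≡⟨ cong₂ ℕ._+_ (∑-cong shifted-roots) (sym (∑-δ-1 0#)) ⟩
    ∑ (λ a → ∑ (λ b → δ (b * (b + two * a)) d)) ℕ.+ ∑ (λ b → δ b 0#)
      ≡⟨ cong (ℕ._+ ∑ (λ b → δ b 0#)) (∑-swap (λ a b → δ (b * (b + two * a)) d)) ⟩
    ∑ (λ b → ∑ (λ a → δ (b * (b + two * a)) d)) ℕ.+ ∑ (λ b → δ b 0#)
      ≡⟨ ∑-+ (λ b → ∑ (λ a → δ (b * (b + two * a)) d)) (λ b → δ b 0#) ⟨
    ∑ (λ b → ∑ (λ a → δ (b * (b + two * a)) d) ℕ.+ δ b 0#)
      ≡⟨ ∑-cong one-solution ⟩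
    ∑ (λ _ → 1)
      ≡⟨ trans (∑-const 1) (ℕ.*-identityʳ size) ⟩
    size ∎
    where
    shifted-roots : ∀ a → #roots (a * a + d) ≡ ∑ (λ b → δ (b * (b + two * a)) d)
    shifted-roots a = trans (∑-translate a (λ b → δ (b * b) (a * a + d))) (∑-cong (λ b → trans
      (cong (λ x → δ x (a * a + d)) (solve 2 (λ a b → (b :+ a) :* (b :+ a) := a :* a :+ b :* (b :+ con 2 :* a)) refl a b))
      (δ-cancelˡ (a * a) _ d)))
    one-solution : ∀ b → ∑ (λ a → δ (b * (b + two * a)) d) ℕ.+ δ b 0# ≡ 1
    one-solution b with b ≟ 0#
    ... | yes refl = cong₂ ℕ._+_ (trans (∑-cong (λ a → δ-≢ (λ 0≡d → d≢0 (trans (sym 0≡d) (zeroˡ (0# + two * a)))))) (trans (∑-const 0) (ℕ.*-zeroʳ size))) (δ-≡ refl)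
    ... | no b≢0 = trans (cong₂ ℕ._+_ (trans (∑-cong affine) (∑-δ-affine (*-nonzero b≢0 (two≢0 odd)) (b * b) d)) (δ-≢ b≢0)) refl
      where
      affine : ∀ a → δ (b * (b + two * a)) d ≡ δ (b * two * a + b * b) d
      affine a = cong (λ x → δ x d) (solve 2 (λ a b → b :* (b :+ con 2 :* a) := b :* con 2 :* a :+ b :* b) refl a b)

  #consecutive : Carrier → ℕ
  #consecutive d = ∑ (λ v → square v ℕ.* square (v + d))

  4*#consecutive : ∀ {d} → d ≢ 0# → 4 ℕ.* #consecutive d ℕ.+ 1 ≡ size ℕ.+ #roots (- d) ℕ.+ #roots d
  4*#consecutive {d} d≢0 = begin
    4 ℕ.* #consecutive d ℕ.+ 1
      ≡⟨ cong (ℕ._+ 1) (trans (*-distribˡ-∑ 4 (λ v → square v ℕ.* square (v + d))) (∑-cong (λ v → double-square-product (square v) (square (v + d))))) ⟩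
    ∑ (λ v → (2 ℕ.* square v) ℕ.* (2 ℕ.* square (v + d))) ℕ.+ 1
      ≡⟨ cong (ℕ._+ 1) (∑-cong (λ v → sym (cong₂ ℕ._*_ (#roots+δ v) (#roots+δ (v + d))))) ⟩
    ∑ (λ v → (r v ℕ.+ z v) ℕ.* (r′ v ℕ.+ z′ v)) ℕ.+ 1
      ≡⟨ cong (ℕ._+ 1) (∑-cong (λ v → expand (r v) (z v) (r′ v) (z′ v))) ⟩
    ∑ (λ v → r v ℕ.* r′ v ℕ.+ (r v ℕ.* z′ v ℕ.+ (z v ℕ.* r′ v ℕ.+ z v ℕ.* z′ v))) ℕ.+ 1
      ≡⟨ cong (ℕ._+ 1) (trans (∑-+ (λ v → r v ℕ.* r′ v) (λ v → r v ℕ.* z′ v ℕ.+ (z v ℕ.* r′ v ℕ.+ z v ℕ.* z′ v))) (cong (∑ (λ v → r v ℕ.* r′ v) ℕ.+_)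
           (trans (∑-+ (λ v → r v ℕ.* z′ v) (λ v → z v ℕ.* r′ v ℕ.+ z v ℕ.* z′ v)) (cong (∑ (λ v → r v ℕ.* z′ v) ℕ.+_) (∑-+ (λ v → z v ℕ.* r′ v) (λ v → z v ℕ.* z′ v)))))) ⟩
    ∑ (λ v → r v ℕ.* r′ v) ℕ.+ (∑ (λ v → r v ℕ.* z′ v) ℕ.+ (∑ (λ v → z v ℕ.* r′ v) ℕ.+ ∑ (λ v → z v ℕ.* z′ v))) ℕ.+ 1
      ≡⟨ cong (λ x → ∑ (λ v → r v ℕ.* r′ v) ℕ.+ x ℕ.+ 1) (cong₂ ℕ._+_ root-at-−d (cong₂ ℕ._+_ root-at-d zero-and-−d)) ⟩
    ∑ (λ v → r v ℕ.* r′ v) ℕ.+ (#roots (- d) ℕ.+ (#roots d ℕ.+ 0)) ℕ.+ 1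
      ≡⟨ rearrange (∑ (λ v → r v ℕ.* r′ v)) (#roots (- d)) (#roots d) ⟩
    (∑ (λ v → r v ℕ.* r′ v) ℕ.+ 1) ℕ.+ #roots (- d) ℕ.+ #roots d
      ≡⟨ cong (λ x → x ℕ.+ #roots (- d) ℕ.+ #roots d) (∑-#roots-product d≢0) ⟩
    size ℕ.+ #roots (- d) ℕ.+ #roots d ∎
    where
    r r′ z z′ : Carrier → ℕ
    r v = #roots v
    r′ v = #roots (v + d)
    z v = δ v 0#
    z′ v = δ (v + d) 0#
    double-square-product : ∀ x y → 4 ℕ.* (x ℕ.* y) ≡ (2 ℕ.* x) ℕ.* (2 ℕ.* y)
    double-square-product = solve-∀
    expand : ∀ a b c e → (a ℕ.+ b) ℕ.* (c ℕ.+ e) ≡ a ℕ.* c ℕ.+ (a ℕ.* e ℕ.+ (b ℕ.* c ℕ.+ b ℕ.* e))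
    expand = solve-∀
    rearrange : ∀ t x y → t ℕ.+ (x ℕ.+ (y ℕ.+ 0)) ℕ.+ 1 ≡ (t ℕ.+ 1) ℕ.+ x ℕ.+ y
    rearrange = solve-∀
    z′≡δ-−d : ∀ v → z′ v ≡ δ v (- d)
    z′≡δ-−d v = trans (cong₂ δ (+-comm v d) (sym (-‿inverseʳ d))) (δ-cancelˡ d v (- d))
    root-at-−d : ∑ (λ v → r v ℕ.* z′ v) ≡ #roots (- d)
    root-at-−d = trans (∑-cong (λ v → trans (ℕ.*-comm (r v) (z′ v)) (cong (ℕ._* r v) (z′≡δ-−d v)))) (∑-δ (- d) r)
    root-at-d : ∑ (λ v → z v ℕ.* r′ v) ≡ #roots d
    root-at-d = trans (∑-δ 0# r′) (cong #roots (+-identityˡ d))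
    zero-and-−d : ∑ (λ v → z v ℕ.* z′ v) ≡ 0
    zero-and-−d = trans (∑-δ 0# z′) (δ-≢ (λ 0+d≡0 → d≢0 (trans (sym (+-identityˡ d)) 0+d≡0)))

  #consecutive-bounds : ∀ {d} → d ≢ 0# → size ≤ 4 ℕ.* #consecutive d ℕ.+ 1 × 4 ℕ.* #consecutive d ℕ.+ 1 ≤ size ℕ.+ 4
  #consecutive-bounds {d} d≢0 =
      ℕ.≤-trans (ℕ.≤-trans (ℕ.m≤m+n size _) (ℕ.m≤m+n _ (#roots d))) (ℕ.≤-reflexive (sym count))
    , ℕ.≤-trans (ℕ.≤-reflexive (trans count (ℕ.+-assoc size _ _))) (ℕ.+-monoʳ-≤ size (ℕ.+-mono-≤ (#roots≤2 (- d)) (#roots≤2 d)))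
    where
    count : 4 ℕ.* #consecutive d ℕ.+ 1 ≡ size ℕ.+ #roots (- d) ℕ.+ #roots d
    count = 4*#consecutive d≢0

module KakeyaSet (F : FiniteField) (odd : ¬ 2 ∣ FiniteField.size F) where

  open FiniteField F using (Carrier; inverse)
  open FieldProperties F
  open Counting F using (allᵛ)
  open Squares F odd
  open ≡-Reasoning

  isZero : Carrier → Bool
  isZero t = does (t ≟ 0#)

  isZero-0 : isZero 0# ≡ true
  isZero-0 = dec-true (0# ≟ 0#) refl

  isZero-≢ : ∀ {t} → t ≢ 0# → isZero t ≡ false
  isZero-≢ {t} = dec-false (t ≟ 0#)

  kakeya : ∀ m → Point F (suc m) → Bool
  kakeya zero _ = true
  kakeya (suc m) (t ∷ x) = allᵛ (λ xᵢ → isSquare (xᵢ + t * t)) x ∨ (isZero t ∧ kakeya m x)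

  -- With 2βγ = 1, each coordinate of the line is (bᵢγ)² + bᵢt, and (bᵢγ)² + bᵢt + (βt)² = (βt + bᵢγ)².
  parabola-line : ∀ {n} {β γ : Carrier} → two * β * γ ≡ 1# → ∀ (b : Vec Carrier n) t →
    allᵛ (λ xᵢ → isSquare (xᵢ + β * t * (β * t))) (linePt F (map (λ bᵢ → bᵢ * γ * (bᵢ * γ)) b) b t) ≡ true
  parabola-line 2βγ≡1 [] t = refl
  parabola-line {β = β} {γ} 2βγ≡1 (bᵢ ∷ b) t = cong₂ _∧_ (dec-true (isSquare? _) (β * t + bᵢ * γ , complete-square)) (parabola-line 2βγ≡1 b t)
    where
    complete-square : (β * t + bᵢ * γ) * (β * t + bᵢ * γ) ≡ bᵢ * γ * (bᵢ * γ) + bᵢ * t + β * t * (β * t)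
    complete-square = begin
      (β * t + bᵢ * γ) * (β * t + bᵢ * γ)
        ≡⟨ solve 4 (λ β t b γ → (β :* t :+ b :* γ) :* (β :* t :+ b :* γ) := b :* γ :* (b :* γ) :+ b :* t :* (con 2 :* β :* γ) :+ β :* t :* (β :* t)) refl β t bᵢ γ ⟩
      bᵢ * γ * (bᵢ * γ) + bᵢ * t * (two * β * γ) + β * t * (β * t)
        ≡⟨ cong (λ x → bᵢ * γ * (bᵢ * γ) + x + β * t * (β * t)) (trans (cong (bᵢ * t *_) 2βγ≡1) (*-identityʳ (bᵢ * t))) ⟩
      bᵢ * γ * (bᵢ * γ) + bᵢ * t + β * t * (β * t) ∎

  kakeya-isKakeya : ∀ m → IsKakeya F (suc m) (kakeya m)
  kakeya-isKakeya zero b b≢0 = zeroPt F 1 , λ t → refl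
  kakeya-isKakeya (suc m) (β ∷ b) β∷b≢0 with β ≟ 0#
  ... | yes refl with kakeya-isKakeya m b (λ b≡0 → β∷b≢0 (cong (0# ∷_) b≡0))
  ...   | a , line⊆K = 0# ∷ a , λ t → begin
          squares t ∨ (isZero (0# + 0# * t) ∧ kakeya m (linePt F a b t))
            ≡⟨ cong (λ z → squares t ∨ (z ∧ kakeya m (linePt F a b t))) (dec-true (_ ≟ 0#) (trans (+-identityˡ _) (zeroˡ t))) ⟩
          squares t ∨ kakeya m (linePt F a b t)
            ≡⟨ cong (squares t ∨_) (line⊆K t) ⟩
          squares t ∨ true
            ≡⟨ Bool.∨-zeroʳ _ ⟩
          true ∎
    where
    squares : Carrier → Bool
    squares t = allᵛ (λ xᵢ → isSquare (xᵢ + (0# + 0# * t) * (0# + 0# * t))) (linePt F a b t)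
  kakeya-isKakeya (suc m) (β ∷ b) β∷b≢0 | no β≢0 with inverse (two * β) (*-nonzero (two≢0 odd) β≢0)
  ... | γ , 2βγ≡1 = 0# ∷ a , λ t → begin
          allᵛ (λ xᵢ → isSquare (xᵢ + (0# + β * t) * (0# + β * t))) (linePt F a b t) ∨ rest t
            ≡⟨ cong (λ u → allᵛ (λ xᵢ → isSquare (xᵢ + u * u)) (linePt F a b t) ∨ rest t) (+-identityˡ (β * t)) ⟩
          allᵛ (λ xᵢ → isSquare (xᵢ + β * t * (β * t))) (linePt F a b t) ∨ rest t
            ≡⟨ cong (_∨ rest t) (parabola-line 2βγ≡1 b t) ⟩
          true ∎
    where
    a : Vec Carrier (suc m)
    a = map (λ bᵢ → bᵢ * γ * (bᵢ * γ)) b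
    rest : Carrier → Bool
    rest t = isZero (0# + β * t) ∧ kakeya m (linePt F a b t)

*-^-distrib : ∀ a b k → (a ℕ.* b) ℕ.^ k ≡ a ℕ.^ k ℕ.* b ℕ.^ k
*-^-distrib a b zero = refl
*-^-distrib a b (suc k) = trans (cong (a ℕ.* b ℕ.*_) (*-^-distrib a b k)) (interchange a b (a ℕ.^ k) (b ℕ.^ k))
  where
  interchange : ∀ a b x y → a ℕ.* b ℕ.* (x ℕ.* y) ≡ a ℕ.* x ℕ.* (b ℕ.* y)
  interchange = ℕ-Solver.solve-∀

module KakeyaCount (F : FiniteField) (odd : ¬ 2 ∣ FiniteField.size F) where

  open FiniteField F using (Carrier; size)
  open FieldProperties F
  open Counting F
  open Squares F odd
  open KakeyaSet F odd
  open import Data.Nat using (_≤_)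
  open ℕ-Solver using (solve-∀)

  #kakeya : ℕ → ℕ
  #kakeya m = card F (suc m) (kakeya m)

  allSquare : ∀ {n} → Point F n → Bool
  allSquare = allᵛ isSquare

  -- the size of the intersection of the two pieces of K_{m+1}
  #overlap : ℕ → ℕ
  #overlap m = card F (suc m) (λ x → allSquare x ∧ kakeya m x)

  nonzeroSquare : Carrier → ℕ
  nonzeroSquare t = square t ℕ.* 𝟙 (not (isZero t))

  #nonzeroSquares : ℕ
  #nonzeroSquares = ∑ nonzeroSquare

  -- the part of #overlap (k + 1) lying over nonzero t
  #overlap⁺ : ℕ → ℕ
  #overlap⁺ k = ∑ (λ t → nonzeroSquare t ℕ.* #consecutive (t * t) ℕ.^ suc k)

  nonzeroSquare-0 : nonzeroSquare 0# ≡ 0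
  nonzeroSquare-0 = trans (cong (λ z → square 0# ℕ.* 𝟙 (not z)) isZero-0) (ℕ.*-zeroʳ (square 0#))

  card-allᵛ-shifted : ∀ n c → card F n (allᵛ (λ v → isSquare (v + c))) ≡ #squares ℕ.^ n
  card-allᵛ-shifted n c = trans (card-allᵛ n _) (cong (ℕ._^ n) (sym (∑-translate c square)))

  allᵛ-shifted-0 : ∀ {n} (x : Vec Carrier n) → allᵛ (λ v → isSquare (v + 0# * 0#)) x ≡ allSquare x
  allᵛ-shifted-0 [] = refl
  allᵛ-shifted-0 (v ∷ x) = cong₂ _∧_ (cong isSquare (trans (cong (v +_) (zeroˡ 0#)) (+-identityʳ v))) (allᵛ-shifted-0 x)

  #kakeya-0 : #kakeya 0 ≡ size
  #kakeya-0 = trans (card-cons 0 (λ _ → true)) (trans (∑-const 1) (ℕ.*-identityʳ size))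

  #kakeya-suc : ∀ m → #kakeya (suc m) ℕ.+ #overlap m ≡ size ℕ.* #squares ℕ.^ suc m ℕ.+ #kakeya m
  #kakeya-suc m = begin
    #kakeya (suc m) ℕ.+ #overlap m
      ≡⟨ cong₂ ℕ._+_ (card-cons (suc m) (kakeya (suc m))) (sym fibre-over-0) ⟩
    ∑ (λ t → card F (suc m) (λ x → A t x ∨ B t x)) ℕ.+ ∑ (λ t → card F (suc m) (λ x → A t x ∧ B t x))
      ≡⟨ ∑-+ (λ t → card F (suc m) (λ x → A t x ∨ B t x)) (λ t → card F (suc m) (λ x → A t x ∧ B t x)) ⟨
    ∑ (λ t → card F (suc m) (λ x → A t x ∨ B t x) ℕ.+ card F (suc m) (λ x → A t x ∧ B t x))
      ≡⟨ ∑-cong (λ t → card-∨ (suc m) (A t) (B t)) ⟩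
    ∑ (λ t → card F (suc m) (A t) ℕ.+ card F (suc m) (B t))
      ≡⟨ ∑-+ (λ t → card F (suc m) (A t)) (λ t → card F (suc m) (B t)) ⟩
    ∑ (λ t → card F (suc m) (A t)) ℕ.+ ∑ (λ t → card F (suc m) (B t))
      ≡⟨ cong₂ ℕ._+_ (trans (∑-cong (λ t → card-allᵛ-shifted (suc m) (t * t))) (∑-const _))
                     (trans (∑-cong (λ t → card-guard (suc m) (isZero t) (kakeya m))) (∑-δ 0# (λ _ → #kakeya m))) ⟩
    size ℕ.* #squares ℕ.^ suc m ℕ.+ #kakeya m ∎
    where
    open ≡-Reasoning
    A B : Carrier → Point F (suc m) → Bool
    A t = allᵛ (λ v → isSquare (v + t * t))
    B t x = isZero t ∧ kakeya m x
    swap : ∀ a z k → (a ∧ (z ∧ k)) ≡ (z ∧ (a ∧ k))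
    swap a true k = refl
    swap a false k = Bool.∧-zeroʳ a
    fibre-over-0 : ∑ (λ t → card F (suc m) (λ x → A t x ∧ B t x)) ≡ #overlap m
    fibre-over-0 = begin
      ∑ (λ t → card F (suc m) (λ x → A t x ∧ B t x))
        ≡⟨ ∑-cong (λ t → trans (card-cong (suc m) (λ x → swap (A t x) (isZero t) (kakeya m x))) (card-guard (suc m) (isZero t) _)) ⟩
      ∑ (λ t → δ t 0# ℕ.* card F (suc m) (λ x → A t x ∧ kakeya m x))
        ≡⟨ ∑-δ 0# (λ t → card F (suc m) (λ x → A t x ∧ kakeya m x)) ⟩
      card F (suc m) (λ x → A 0# x ∧ kakeya m x)
        ≡⟨ card-cong (suc m) (λ x → cong (_∧ kakeya m x) (allᵛ-shifted-0 x)) ⟩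
      #overlap m ∎

  #overlap-0 : #overlap 0 ≡ #squares
  #overlap-0 = trans (card-cong 1 (λ x → Bool.∧-identityʳ (allSquare x)))
                     (trans (card-allᵛ 1 isSquare) (ℕ.*-identityʳ #squares))

  -- Over t ≠ 0 the fibre consists of the y with all yᵢ and yᵢ + t² squares.
  #overlap-fibre : ∀ k t → square t ℕ.* card F (suc k) (λ y → allSquare y ∧ kakeya (suc k) (t ∷ y))
                           ≡ δ t 0# ℕ.* #squares ℕ.^ suc k ℕ.+ nonzeroSquare t ℕ.* #consecutive (t * t) ℕ.^ suc k
  #overlap-fibre k t with t ≟ 0#
  ... | yes refl = begin
    square 0# ℕ.* card F (suc k) (λ y → allSquare y ∧ (allᵛ (λ v → isSquare (v + 0# * 0#)) y ∨ (isZero 0# ∧ kakeya k y)))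
      ≡⟨ cong₂ ℕ._*_ (square-≡1 (0# , zeroˡ 0#)) (card-cong (suc k) (λ y → trans
           (cong₂ (λ a z → allSquare y ∧ (a ∨ (z ∧ kakeya k y))) (allᵛ-shifted-0 y) isZero-0) (Bool.∧-abs-∨ (allSquare y) _))) ⟩
    1 ℕ.* card F (suc k) allSquare
      ≡⟨ trans (ℕ.*-identityˡ _) (card-allᵛ (suc k) isSquare) ⟩
    sᵏ
      ≡⟨ ℕ.+-identityʳ sᵏ ⟨
    sᵏ ℕ.+ 0
      ≡⟨ cong₂ ℕ._+_ (trans (cong (ℕ._* sᵏ) (δ-≡ refl)) (ℕ.*-identityˡ sᵏ)) (cong (ℕ._* Nᵏ 0#) nonzeroSquare-0) ⟨
    δ 0# 0# ℕ.* sᵏ ℕ.+ nonzeroSquare 0# ℕ.* Nᵏ 0# ∎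
    where
    open ≡-Reasoning
    sᵏ : ℕ
    sᵏ = #squares ℕ.^ suc k
    Nᵏ : Carrier → ℕ
    Nᵏ t = #consecutive (t * t) ℕ.^ suc k
  ... | no t≢0 = begin
    square t ℕ.* card F (suc k) (λ y → allSquare y ∧ (shifted y ∨ (isZero t ∧ kakeya k y)))
      ≡⟨ cong (square t ℕ.*_) (card-cong (suc k) (λ y → trans (cong (λ z → allSquare y ∧ (shifted y ∨ (z ∧ kakeya k y))) (isZero-≢ t≢0))
           (trans (cong (allSquare y ∧_) (Bool.∨-identityʳ _)) (allᵛ-∧ isSquare (λ v → isSquare (v + t * t)) y)))) ⟩
    square t ℕ.* card F (suc k) (allᵛ (λ v → isSquare v ∧ isSquare (v + t * t)))
      ≡⟨ cong (square t ℕ.*_) (card-allᵛ (suc k) (λ v → isSquare v ∧ isSquare (v + t * t))) ⟩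
    square t ℕ.* ∑ (λ v → 𝟙 (isSquare v ∧ isSquare (v + t * t))) ℕ.^ suc k
      ≡⟨ cong (λ z → square t ℕ.* z ℕ.^ suc k) (∑-cong (λ v → 𝟙-∧ (isSquare v) (isSquare (v + t * t)))) ⟩
    square t ℕ.* Nᵏ
      ≡⟨ cong (ℕ._* Nᵏ) (ℕ.*-identityʳ (square t)) ⟨
    0 ℕ.+ square t ℕ.* 1 ℕ.* Nᵏ
      ≡⟨ cong₂ ℕ._+_ (cong (ℕ._* #squares ℕ.^ suc k) (δ-≢ t≢0)) (cong (λ z → square t ℕ.* 𝟙 (not z) ℕ.* Nᵏ) (isZero-≢ t≢0)) ⟨
    δ t 0# ℕ.* #squares ℕ.^ suc k ℕ.+ nonzeroSquare t ℕ.* Nᵏ ∎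
    where
    open ≡-Reasoning
    shifted : Vec Carrier (suc k) → Bool
    shifted = allᵛ (λ v → isSquare (v + t * t))
    Nᵏ : ℕ
    Nᵏ = #consecutive (t * t) ℕ.^ suc k

  #overlap-suc : ∀ k → #overlap (suc k) ≡ #squares ℕ.^ suc k ℕ.+ #overlap⁺ k
  #overlap-suc k = begin
    #overlap (suc k)
      ≡⟨ card-cons (suc k) (λ x → allSquare x ∧ kakeya (suc k) x) ⟩
    ∑ (λ t → card F (suc k) (λ y → (isSquare t ∧ allSquare y) ∧ K t y))
      ≡⟨ ∑-cong (λ t → trans (card-cong (suc k) (λ y → Bool.∧-assoc (isSquare t) (allSquare y) (K t y)))
                             (card-guard (suc k) (isSquare t) (λ y → allSquare y ∧ K t y))) ⟩
    ∑ (λ t → square t ℕ.* card F (suc k) (λ y → allSquare y ∧ K t y))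
      ≡⟨ ∑-cong (#overlap-fibre k) ⟩
    ∑ (λ t → δ t 0# ℕ.* sᵏ ℕ.+ nonzeroSquare t ℕ.* #consecutive (t * t) ℕ.^ suc k)
      ≡⟨ ∑-+ (λ t → δ t 0# ℕ.* sᵏ) (λ t → nonzeroSquare t ℕ.* #consecutive (t * t) ℕ.^ suc k) ⟩
    ∑ (λ t → δ t 0# ℕ.* sᵏ) ℕ.+ #overlap⁺ k
      ≡⟨ cong (ℕ._+ #overlap⁺ k) (∑-δ 0# (λ _ → sᵏ)) ⟩
    sᵏ ℕ.+ #overlap⁺ k ∎
    where
    open ≡-Reasoning
    sᵏ : ℕ
    sᵏ = #squares ℕ.^ suc k
    K : Carrier → Vec Carrier (suc k) → Bool
    K t y = kakeya (suc k) (t ∷ y)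

  1+2*#nonzeroSquares : 1 ℕ.+ 2 ℕ.* #nonzeroSquares ≡ size
  1+2*#nonzeroSquares = ℕ.+-cancelˡ-≡ 1 _ _ (begin
    1 ℕ.+ (1 ℕ.+ 2 ℕ.* #nonzeroSquares) ≡⟨ regroup #nonzeroSquares ⟩
    2 ℕ.* (1 ℕ.+ #nonzeroSquares)       ≡⟨ cong (2 ℕ.*_) 1+#nonzeroSquares ⟩
    2 ℕ.* #squares                      ≡⟨ 2*#squares ⟩
    size ℕ.+ 1                          ≡⟨ ℕ.+-comm size 1 ⟩
    1 ℕ.+ size                          ∎)
    where
    open ≡-Reasoning
    regroup : ∀ g → 1 ℕ.+ (1 ℕ.+ 2 ℕ.* g) ≡ 2 ℕ.* (1 ℕ.+ g)
    regroup = solve-∀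
    split : ∀ t → δ t 0# ℕ.* square t ℕ.+ nonzeroSquare t ≡ square t
    split t with t ≟ 0#
    ... | yes refl = trans (cong₂ ℕ._+_ (trans (cong (ℕ._* square 0#) (δ-≡ refl)) (ℕ.*-identityˡ _)) nonzeroSquare-0) (ℕ.+-identityʳ _)
    ... | no t≢0 = trans (cong (λ z → δ t 0# ℕ.* square t ℕ.+ square t ℕ.* 𝟙 (not z)) (isZero-≢ t≢0))
                         (trans (cong (ℕ._+ square t ℕ.* 1) (cong (ℕ._* square t) (δ-≢ t≢0))) (ℕ.*-identityʳ _))
    1+#nonzeroSquares : 1 ℕ.+ #nonzeroSquares ≡ #squares
    1+#nonzeroSquares = begin
      1 ℕ.+ #nonzeroSquares                               ≡⟨ cong (ℕ._+ #nonzeroSquares) (square-≡1 (0# , zeroˡ 0#)) ⟨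
      square 0# ℕ.+ #nonzeroSquares                       ≡⟨ cong (ℕ._+ #nonzeroSquares) (∑-δ 0# square) ⟨
      ∑ (λ t → δ t 0# ℕ.* square t) ℕ.+ #nonzeroSquares  ≡⟨ ∑-+ (λ t → δ t 0# ℕ.* square t) nonzeroSquare ⟨
      ∑ (λ t → δ t 0# ℕ.* square t ℕ.+ nonzeroSquare t)  ≡⟨ ∑-cong split ⟩
      #squares ∎

  4*#consecutive-bounds : ∀ {t} → t ≢ 0# →
    2 ℕ.* #nonzeroSquares ≤ 4 ℕ.* #consecutive (t * t) × 4 ℕ.* #consecutive (t * t) ≤ 2 ℕ.* #nonzeroSquares ℕ.+ 4
  4*#consecutive-bounds t≢0 with #consecutive-bounds (*-nonzero t≢0 t≢0)
  ... | lower , upper =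
      ℕ.+-cancelˡ-≤ 1 _ _ (ℕ.≤-trans (ℕ.≤-reflexive 1+2*#nonzeroSquares) (ℕ.≤-trans lower (ℕ.≤-reflexive (ℕ.+-comm _ 1))))
    , ℕ.+-cancelˡ-≤ 1 _ _ (ℕ.≤-trans (ℕ.≤-reflexive (ℕ.+-comm 1 _)) (ℕ.≤-trans upper
        (ℕ.≤-reflexive (trans (cong (ℕ._+ 4) (sym 1+2*#nonzeroSquares)) (ℕ.+-assoc 1 _ 4)))))

  #overlap⁺-bounds : ∀ k →
    #nonzeroSquares ℕ.* (2 ℕ.* #nonzeroSquares) ℕ.^ suc k ≤ 4 ℕ.^ suc k ℕ.* #overlap⁺ k ×
    4 ℕ.^ suc k ℕ.* #overlap⁺ k ≤ #nonzeroSquares ℕ.* (2 ℕ.* #nonzeroSquares ℕ.+ 4) ℕ.^ suc k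
  #overlap⁺-bounds k =
      (begin
        #nonzeroSquares ℕ.* (2 ℕ.* #nonzeroSquares) ℕ.^ suc k
          ≡⟨ *-distribʳ-∑ _ nonzeroSquare ⟩
        ∑ (λ t → nonzeroSquare t ℕ.* (2 ℕ.* #nonzeroSquares) ℕ.^ suc k)
          ≤⟨ ∑-mono-≤ (λ t → nonzeroSquare-mono t (λ t≢0 → ℕ.^-monoˡ-≤ (suc k) (proj₁ (4*#consecutive-bounds t≢0)))) ⟩
        ∑ (λ t → nonzeroSquare t ℕ.* (4 ℕ.* #consecutive (t * t)) ℕ.^ suc k)
          ≡⟨ scaled ⟨
        4 ℕ.^ suc k ℕ.* #overlap⁺ k ∎)
    , (begin
        4 ℕ.^ suc k ℕ.* #overlap⁺ k
          ≡⟨ scaled ⟩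
        ∑ (λ t → nonzeroSquare t ℕ.* (4 ℕ.* #consecutive (t * t)) ℕ.^ suc k)
          ≤⟨ ∑-mono-≤ (λ t → nonzeroSquare-mono t (λ t≢0 → ℕ.^-monoˡ-≤ (suc k) (proj₂ (4*#consecutive-bounds t≢0)))) ⟩
        ∑ (λ t → nonzeroSquare t ℕ.* (2 ℕ.* #nonzeroSquares ℕ.+ 4) ℕ.^ suc k)
          ≡⟨ *-distribʳ-∑ _ nonzeroSquare ⟨
        #nonzeroSquares ℕ.* (2 ℕ.* #nonzeroSquares ℕ.+ 4) ℕ.^ suc k ∎)
    where
    open ℕ.≤-Reasoning
    nonzeroSquare-mono : ∀ t {a b} → (t ≢ 0# → a ≤ b) → nonzeroSquare t ℕ.* a ≤ nonzeroSquare t ℕ.* b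
    nonzeroSquare-mono t {a} {b} a≤b with t ≟ 0#
    ... | yes refl = ℕ.≤-reflexive (trans (cong (ℕ._* a) nonzeroSquare-0) (sym (cong (ℕ._* b) nonzeroSquare-0)))
    ... | no t≢0 = ℕ.*-monoʳ-≤ (nonzeroSquare t) (a≤b t≢0)
    regroup : ∀ c a b → c ℕ.^ suc k ℕ.* (a ℕ.* b ℕ.^ suc k) ≡ a ℕ.* (c ℕ.* b) ℕ.^ suc k
    regroup c a b = trans (solve-∀-helper (c ℕ.^ suc k) a (b ℕ.^ suc k)) (cong (a ℕ.*_) (sym (*-^-distrib c b (suc k))))
      where
      solve-∀-helper : ∀ x y z → x ℕ.* (y ℕ.* z) ≡ y ℕ.* (x ℕ.* z)
      solve-∀-helper = solve-∀
    scaled : 4 ℕ.^ suc k ℕ.* #overlap⁺ k ≡ ∑ (λ t → nonzeroSquare t ℕ.* (4 ℕ.* #consecutive (t * t)) ℕ.^ suc k)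
    scaled = trans (*-distribˡ-∑ (4 ℕ.^ suc k) (λ t → nonzeroSquare t ℕ.* #consecutive (t * t) ℕ.^ suc k)) (∑-cong (λ t → regroup 4 (nonzeroSquare t) (#consecutive (t * t))))

module _ where

  open import Data.Integer using (+_; -[1+_]; 0ℤ; _+_; _-_; _*_; -_; _^_; ∣_∣; _≤_; -≤+; +≤+)
  open ℤ-Solver using (solve-∀)

  i≤+∣i∣ : ∀ i → i ≤ + ∣ i ∣
  i≤+∣i∣ (+ n) = ℤ.≤-refl
  i≤+∣i∣ -[1+ n ] = -≤+

  -i≤+∣i∣ : ∀ i → - i ≤ + ∣ i ∣
  -i≤+∣i∣ (+ zero) = ℤ.≤-refl
  -i≤+∣i∣ (+ suc n) = -≤+
  -i≤+∣i∣ -[1+ n ] = ℤ.≤-refl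

  ∣∣-sandwich : ∀ {l x u} → l ≤ x → x ≤ u → ∣ x ∣ ℕ.≤ ∣ l ∣ ℕ.+ ∣ u ∣
  ∣∣-sandwich {l} {+ n} {u} _ x≤u = ℕ.≤-trans (ℤ.drop‿+≤+ (ℤ.≤-trans x≤u (i≤+∣i∣ u))) (ℕ.m≤n+m ∣ u ∣ ∣ l ∣)
  ∣∣-sandwich {l} { -[1+ n ]} {u} l≤x _ = ℕ.≤-trans (ℤ.drop‿+≤+ (ℤ.≤-trans (ℤ.neg-mono-≤ l≤x) (-i≤+∣i∣ l))) (ℕ.m≤m+n ∣ l ∣ ∣ u ∣)

  ∣+n^k∣ : ∀ n k → ∣ (+ n) ^ k ∣ ≡ n ℕ.^ k
  ∣+n^k∣ n zero = refl
  ∣+n^k∣ n (suc k) = trans (ℤ.abs-* (+ n) ((+ n) ^ k)) (cong (n ℕ.*_) (∣+n^k∣ n k))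

  pos-^ : ∀ a k → + (a ℕ.^ k) ≡ (+ a) ^ k
  pos-^ a zero = refl
  pos-^ a (suc k) = trans (ℤ.pos-* a (a ℕ.^ k)) (cong (+ a *_) (pos-^ a k))

  ∣i-j∣≤e⇒i≤j+e : ∀ i j e → ∣ i - j ∣ ℕ.≤ e → i ≤ j + + e
  ∣i-j∣≤e⇒i≤j+e i j e ∣i-j∣≤e = begin
    i             ≡⟨ split i j ⟩
    j + (i - j)   ≤⟨ ℤ.+-monoʳ-≤ j (ℤ.≤-trans (i≤+∣i∣ (i - j)) (+≤+ ∣i-j∣≤e)) ⟩
    j + + e       ∎
    where
    open ℤ.≤-Reasoning
    split : ∀ i j → i ≡ j + (i - j)
    split = solve-∀

  ∣a-b∣≤e⇒a≤b+e : ∀ {a b e} → ∣ + a - + b ∣ ℕ.≤ e → a ℕ.≤ b ℕ.+ e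
  ∣a-b∣≤e⇒a≤b+e {a} {b} {e} ∣a-b∣≤e = ℤ.drop‿+≤+ (∣i-j∣≤e⇒i≤j+e (+ a) (+ b) e ∣a-b∣≤e)

  module BigO {ℓ} {I : Set ℓ} (q : I → ℕ) (q≥1 : ∀ i → 1 ℕ.≤ q i) where

    Q : I → ℤ
    Q i = + q i

    infix 4 _≈[_]_
    record _≈[_]_ (f : I → ℤ) (k : ℕ) (g : I → ℤ) : Set ℓ where
      constructor _,_
      field
        constant : ℕ
        bound : ∀ i → ∣ f i - g i ∣ ℕ.≤ constant ℕ.* q i ℕ.^ k

    private
      split-bound : ∀ {x} y z D₁ D₂ n → x ≡ y + z → ∣ y ∣ ℕ.≤ D₁ ℕ.* n → ∣ z ∣ ℕ.≤ D₂ ℕ.* n → ∣ x ∣ ℕ.≤ (D₁ ℕ.+ D₂) ℕ.* n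
      split-bound {x} y z D₁ D₂ n x≡y+z y≤ z≤ = begin
        ∣ x ∣             ≡⟨ cong ∣_∣ x≡y+z ⟩
        ∣ y + z ∣         ≤⟨ ℤ.∣i+j∣≤∣i∣+∣j∣ y z ⟩
        ∣ y ∣ ℕ.+ ∣ z ∣   ≤⟨ ℕ.+-mono-≤ y≤ z≤ ⟩
        D₁ ℕ.* n ℕ.+ D₂ ℕ.* n ≡⟨ ℕ.*-distribʳ-+ n D₁ D₂ ⟨
        (D₁ ℕ.+ D₂) ℕ.* n ∎
        where open ℕ.≤-Reasoning
      telescope : ∀ a b c → a - c ≡ (a - b) + (b - c)
      telescope = solve-∀
      interchange : ∀ a b c d → (a + b) - (c + d) ≡ (a - c) + (b - d)
      interchange = solve-∀
      interchange⁻ : ∀ a b c d → (a - b) - (c - d) ≡ (a - c) + - (b - d)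
      interchange⁻ = solve-∀
      factor : ∀ a b c → a * b - a * c ≡ a * (b - c)
      factor = solve-∀

    ≈-reflexive : ∀ {k f g} → (∀ i → f i ≡ g i) → f ≈[ k ] g
    ≈-reflexive f≗g = 0 , λ i → ℕ.≤-reflexive (cong ∣_∣ (ℤ.i≡j⇒i-j≡0 (f≗g i)))

    ≈-sym : ∀ {k f g} → f ≈[ k ] g → g ≈[ k ] f
    ≈-sym {f = f} {g} (D , f≈g) = D , λ i → subst (ℕ._≤ _) (ℤ.∣i-j∣≡∣j-i∣ (f i) (g i)) (f≈g i)

    ≈-trans : ∀ {k f g h} → f ≈[ k ] g → g ≈[ k ] h → f ≈[ k ] h
    ≈-trans {k} {f} {g} {h} (D₁ , f≈g) (D₂ , g≈h) = (D₁ ℕ.+ D₂) , λ i → split-bound (f i - g i) (g i - h i) D₁ D₂ (q i ℕ.^ k) (telescope (f i) (g i) (h i)) (f≈g i) (g≈h i)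

    ≈-+ : ∀ {k f f′ g g′} → f ≈[ k ] g → f′ ≈[ k ] g′ → (λ i → f i + f′ i) ≈[ k ] (λ i → g i + g′ i)
    ≈-+ {k} {f} {f′} {g} {g′} (D₁ , f≈g) (D₂ , f′≈g′) =
      (D₁ ℕ.+ D₂) , λ i → split-bound (f i - g i) (f′ i - g′ i) D₁ D₂ (q i ℕ.^ k) (interchange (f i) (f′ i) (g i) (g′ i)) (f≈g i) (f′≈g′ i)

    ≈-− : ∀ {k f f′ g g′} → f ≈[ k ] g → f′ ≈[ k ] g′ → (λ i → f i - f′ i) ≈[ k ] (λ i → g i - g′ i)
    ≈-− {k} {f} {f′} {g} {g′} (D₁ , f≈g) (D₂ , f′≈g′) =
      (D₁ ℕ.+ D₂) , λ i → split-bound (f i - g i) (- (f′ i - g′ i)) D₁ D₂ (q i ℕ.^ k) (interchange⁻ (f i) (f′ i) (g i) (g′ i)) (f≈g i)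
                                    (subst (ℕ._≤ _) (sym (ℤ.∣-i∣≡∣i∣ (f′ i - g′ i))) (f′≈g′ i))

    ≈-+ˡ : ∀ {k f g} h → f ≈[ k ] g → (λ i → h i + f i) ≈[ k ] (λ i → h i + g i)
    ≈-+ˡ h = ≈-+ (≈-reflexive {f = h} {g = h} (λ _ → refl))

    ≈-*ˡ : ∀ {k f g} a → f ≈[ k ] g → (λ i → a * f i) ≈[ k ] (λ i → a * g i)
    ≈-*ˡ {k} {f} {g} a (D , f≈g) = (∣ a ∣ ℕ.* D) , λ i → begin
      ∣ a * f i - a * g i ∣          ≡⟨ cong ∣_∣ (factor a (f i) (g i)) ⟩
      ∣ a * (f i - g i) ∣            ≡⟨ ℤ.abs-* a (f i - g i) ⟩
      ∣ a ∣ ℕ.* ∣ f i - g i ∣        ≤⟨ ℕ.*-monoʳ-≤ ∣ a ∣ (f≈g i) ⟩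
      ∣ a ∣ ℕ.* (D ℕ.* q i ℕ.^ k)    ≡⟨ ℕ.*-assoc ∣ a ∣ D _ ⟨
      ∣ a ∣ ℕ.* D ℕ.* q i ℕ.^ k      ∎
      where open ℕ.≤-Reasoning

    ≈-*Q : ∀ {k f g} → f ≈[ k ] g → (λ i → Q i * f i) ≈[ suc k ] (λ i → Q i * g i)
    ≈-*Q {k} {f} {g} (D , f≈g) = D , λ i → begin
      ∣ Q i * f i - Q i * g i ∣      ≡⟨ cong ∣_∣ (factor (Q i) (f i) (g i)) ⟩
      ∣ Q i * (f i - g i) ∣          ≡⟨ ℤ.abs-* (Q i) (f i - g i) ⟩
      q i ℕ.* ∣ f i - g i ∣          ≤⟨ ℕ.*-monoʳ-≤ (q i) (f≈g i) ⟩
      q i ℕ.* (D ℕ.* q i ℕ.^ k)      ≡⟨ x∙yz≈y∙xz (q i) D _ ⟩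
      D ℕ.* (q i ℕ.* q i ℕ.^ k)      ∎
      where open ℕ.≤-Reasoning

    ≈-weaken : ∀ {k f g} → f ≈[ k ] g → f ≈[ suc k ] g
    ≈-weaken {k} (D , f≈g) = D , λ i → ℕ.≤-trans (f≈g i) (ℕ.*-monoʳ-≤ D (ℕ.≤-trans
      (ℕ.≤-reflexive (sym (ℕ.*-identityˡ (q i ℕ.^ k)))) (ℕ.*-monoˡ-≤ (q i ℕ.^ k) (q≥1 i))))

    a*Q^k≈0 : ∀ a k → (λ i → a * Q i ^ k) ≈[ k ] (λ _ → 0ℤ)
    a*Q^k≈0 a k = ∣ a ∣ , λ i → ℕ.≤-reflexive (begin
      ∣ a * Q i ^ k - 0ℤ ∣       ≡⟨ cong ∣_∣ (ℤ.+-identityʳ (a * Q i ^ k)) ⟩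
      ∣ a * Q i ^ k ∣            ≡⟨ ℤ.abs-* a (Q i ^ k) ⟩
      ∣ a ∣ ℕ.* ∣ Q i ^ k ∣      ≡⟨ cong (∣ a ∣ ℕ.*_) (∣+n^k∣ (q i) k) ⟩
      ∣ a ∣ ℕ.* q i ℕ.^ k        ∎)
      where open ≡-Reasoning

    ≈-sandwich : ∀ {k l f u g} → (∀ i → l i ≤ f i) → (∀ i → f i ≤ u i) → l ≈[ k ] g → u ≈[ k ] g → f ≈[ k ] g
    ≈-sandwich {g = g} l≤f f≤u (D₁ , l≈g) (D₂ , u≈g) = (D₁ ℕ.+ D₂) , λ i → ℕ.≤-trans
      (∣∣-sandwich (ℤ.+-monoˡ-≤ (- g i) (l≤f i)) (ℤ.+-monoˡ-≤ (- g i) (f≤u i)))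
      (ℕ.≤-trans (ℕ.+-mono-≤ (l≈g i) (u≈g i)) (ℕ.≤-reflexive (sym (ℕ.*-distribʳ-+ _ D₁ D₂))))

    ≈-setoid : ℕ → Setoid _ _
    ≈-setoid k = record
      { Carrier = I → ℤ
      ; _≈_ = _≈[ k ]_
      ; isEquivalence = record { refl = ≈-reflexive (λ _ → refl) ; sym = ≈-sym ; trans = ≈-trans }
      }

    module ≈-Reasoning (k : ℕ) = SetoidReasoning (≈-setoid k)

    binomial-leading : ∀ a k → (λ i → (Q i + a) ^ suc k) ≈[ k ] (λ i → Q i ^ suc k)
    binomial-leading a zero = begin
      (λ i → (Q i + a) ^ 1)        ≈⟨ ≈-reflexive (λ i → degree-one (Q i) a) ⟩
      (λ i → Q i ^ 1 + a * Q i ^ 0) ≈⟨ ≈-+ˡ (λ i → Q i ^ 1) (a*Q^k≈0 a 0) ⟩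
      (λ i → Q i ^ 1 + 0ℤ)          ≈⟨ ≈-reflexive (λ i → ℤ.+-identityʳ (Q i ^ 1)) ⟩
      (λ i → Q i ^ 1)               ∎
      where
      open ≈-Reasoning 0
      degree-one : ∀ x a → (x + a) * + 1 ≡ x * + 1 + a * + 1
      degree-one = solve-∀
    binomial-leading a (suc k) = begin
      (λ i → (Q i + a) ^ suc (suc k))
        ≈⟨ ≈-reflexive (λ i → ℤ.*-distribʳ-+ ((Q i + a) ^ suc k) (Q i) a) ⟩
      (λ i → Q i * (Q i + a) ^ suc k + a * (Q i + a) ^ suc k)
        ≈⟨ ≈-+ (≈-*Q (binomial-leading a k)) (≈-weaken (≈-*ˡ a (binomial-leading a k))) ⟩
      (λ i → Q i ^ suc (suc k) + a * Q i ^ suc k)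
        ≈⟨ ≈-+ˡ (λ i → Q i ^ suc (suc k)) (a*Q^k≈0 a (suc k)) ⟩
      (λ i → Q i ^ suc (suc k) + 0ℤ)
        ≈⟨ ≈-reflexive (λ i → ℤ.+-identityʳ (Q i ^ suc (suc k))) ⟩
      (λ i → Q i ^ suc (suc k)) ∎
      where open ≈-Reasoning (suc k)

    binomial-two-terms : ∀ a k →
      (λ i → Q i * (Q i + a) ^ suc k) ≈[ k ] (λ i → Q i ^ suc (suc k) + + suc k * a * Q i ^ suc k)
    binomial-two-terms a zero = ≈-reflexive (λ i → degree-two (Q i) a)
      where
      degree-two : ∀ x a → x * ((x + a) * + 1) ≡ x * (x * + 1) + + 1 * a * (x * + 1)
      degree-two = solve-∀
    binomial-two-terms a (suc k) = begin
      (λ i → Q i * (Q i + a) ^ suc (suc k))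
        ≈⟨ ≈-reflexive (λ i → peel (Q i) a ((Q i + a) ^ suc k)) ⟩
      (λ i → Q i * (Q i * (Q i + a) ^ suc k) + a * (Q i * (Q i + a) ^ suc k))
        ≈⟨ ≈-+ (≈-*Q (binomial-two-terms a k)) (≈-weaken (≈-*ˡ a (binomial-two-terms a k))) ⟩
      (λ i → Q i * (Q i ^ suc (suc k) + c * a * Q i ^ suc k) + a * (Q i ^ suc (suc k) + c * a * Q i ^ suc k))
        ≈⟨ ≈-reflexive (λ i → collect (Q i) a c (Q i ^ suc k)) ⟩
      (λ i → Q i ^ suc (suc (suc k)) + (+ 1 + c) * a * Q i ^ suc (suc k) + c * a * a * Q i ^ suc k)
        ≈⟨ ≈-+ˡ (λ i → Q i ^ suc (suc (suc k)) + (+ 1 + c) * a * Q i ^ suc (suc k)) (a*Q^k≈0 (c * a * a) (suc k)) ⟩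
      (λ i → Q i ^ suc (suc (suc k)) + (+ 1 + c) * a * Q i ^ suc (suc k) + 0ℤ)
        ≈⟨ ≈-reflexive (λ i → ℤ.+-identityʳ _) ⟩
      (λ i → Q i ^ suc (suc (suc k)) + + suc (suc k) * a * Q i ^ suc (suc k)) ∎
      where
      open ≈-Reasoning (suc k)
      c : ℤ
      c = + suc k
      peel : ∀ x a y → x * ((x + a) * y) ≡ x * (x * y) + a * (x * y)
      peel = solve-∀
      collect : ∀ x a c y → x * (x * y + c * a * y) + a * (x * y + c * a * y)
                            ≡ x * (x * y) + (+ 1 + c) * a * (x * y) + c * a * a * y
      collect = solve-∀

    polynomial-O : ∀ a k → (λ i → (Q i + a) ^ k) ≈[ k ] (λ _ → 0ℤ)
    polynomial-O a zero = 1 , λ _ → ℕ.≤-refl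
    polynomial-O a (suc k) = ≈-trans (≈-weaken (binomial-leading a k))
      (≈-trans (≈-reflexive (λ i → sym (ℤ.*-identityˡ (Q i ^ suc k)))) (a*Q^k≈0 (+ 1) (suc k)))

-- 4^m q (c - mainTerm (m + 1) q) = scaledCount m c q - scaledMain m q
scaledCount : (m c q : ℕ) → ℕ
scaledCount m c q = 4 ℕ.^ m ℕ.* q ℕ.* c ℕ.+ 2 ℕ.* q ℕ.^ suc m

scaledMain : (m q : ℕ) → ℕ
scaledMain m q = 2 ℕ.^ m ℕ.* q ℕ.^ suc (suc m) ℕ.+ 2 ℕ.^ m ℕ.* (2 ℕ.+ m) ℕ.* q ℕ.^ suc m

module _ where

  open import Data.Integer using (+_; 0ℤ; 1ℤ; -1ℤ; _+_; _-_; _*_; _^_; ∣_∣; _≤_; +≤+)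
  open ℤ-Solver using (solve-∀)

  OddField : Set₁
  OddField = Σ FiniteField λ F → ¬ 2 ∣ FiniteField.size F

  module KakeyaAsymptotics where

    q : OddField → ℕ
    q (F , _) = FiniteField.size F

    1≤q : ∀ i → 1 ℕ.≤ q i
    1≤q (F , odd) = ℕ.>-nonZero⁻¹ _ {{odd⇒nonZero _ odd}}

    open BigO q 1≤q

    #K #O #O⁺ : ℕ → OddField → ℕ
    #K m (F , odd) = KakeyaCount.#kakeya F odd m
    #O m (F , odd) = KakeyaCount.#overlap F odd m
    #O⁺ k (F , odd) = KakeyaCount.#overlap⁺ F odd k

    #S #G : OddField → ℕ
    #S (F , odd) = Squares.#squares F odd
    #G (F , odd) = KakeyaCount.#nonzeroSquares F odd

    Q-1≡2G : ∀ i → Q i + -1ℤ ≡ + (2 ℕ.* #G i)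
    Q-1≡2G i@(F , odd) = trans (cong (λ n → + n + -1ℤ) (sym (KakeyaCount.1+2*#nonzeroSquares F odd))) (cancel (+ (2 ℕ.* #G i)))
      where
      cancel : ∀ x → + 1 + x + -1ℤ ≡ x
      cancel = solve-∀

    Q+3≡2G+4 : ∀ i → Q i + + 3 ≡ + (2 ℕ.* #G i ℕ.+ 4)
    Q+3≡2G+4 i@(F , odd) = trans (cong (λ n → + n + + 3) (sym (KakeyaCount.1+2*#nonzeroSquares F odd))) (shift (+ (2 ℕ.* #G i)))
      where
      shift : ∀ x → + 1 + x + + 3 ≡ x + + 4
      shift = solve-∀

    overlap⁺-≈ : ∀ k → (λ i → + (2 ℕ.* (4 ℕ.^ suc k ℕ.* #O⁺ k i))) ≈[ suc k ] (λ i → Q i ^ suc (suc k))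
    overlap⁺-≈ k = ≈-sandwich lower upper (binomial-leading -1ℤ (suc k)) upper≈
      where
      K : ℕ
      K = suc k
      regroup : ∀ g x → 2 ℕ.* g ℕ.* x ≡ 2 ℕ.* (g ℕ.* x)
      regroup = ℕ-Solver.solve-∀
      lower : ∀ i → (Q i + -1ℤ) ^ suc K ≤ + (2 ℕ.* (4 ℕ.^ K ℕ.* #O⁺ k i))
      lower i@(F , odd) = begin
        (Q i + -1ℤ) ^ suc K                 ≡⟨ cong (_^ suc K) (Q-1≡2G i) ⟩
        (+ (2 ℕ.* #G i)) ^ suc K            ≡⟨ pos-^ (2 ℕ.* #G i) (suc K) ⟨
        + (2 ℕ.* #G i ℕ.* (2 ℕ.* #G i) ℕ.^ K) ≤⟨ +≤+ (ℕ.≤-trans (ℕ.≤-reflexive (regroup (#G i) _))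
                                                   (ℕ.*-monoʳ-≤ 2 (proj₁ (KakeyaCount.#overlap⁺-bounds F odd k)))) ⟩
        + (2 ℕ.* (4 ℕ.^ K ℕ.* #O⁺ k i))     ∎
        where open ℤ.≤-Reasoning
      upper : ∀ i → + (2 ℕ.* (4 ℕ.^ K ℕ.* #O⁺ k i)) ≤ (Q i + -1ℤ) * (Q i + + 3) ^ K
      upper i@(F , odd) = begin
        + (2 ℕ.* (4 ℕ.^ K ℕ.* #O⁺ k i))                 ≤⟨ +≤+ (ℕ.≤-trans (ℕ.*-monoʳ-≤ 2 (proj₂ (KakeyaCount.#overlap⁺-bounds F odd k)))
                                                             (ℕ.≤-reflexive (sym (regroup (#G i) _)))) ⟩
        + (2 ℕ.* #G i ℕ.* (2 ℕ.* #G i ℕ.+ 4) ℕ.^ K)     ≡⟨ ℤ.pos-* (2 ℕ.* #G i) _ ⟩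
        + (2 ℕ.* #G i) * + ((2 ℕ.* #G i ℕ.+ 4) ℕ.^ K)   ≡⟨ cong (+ (2 ℕ.* #G i) *_) (pos-^ _ K) ⟩
        + (2 ℕ.* #G i) * (+ (2 ℕ.* #G i ℕ.+ 4)) ^ K     ≡⟨ cong₂ (λ a b → a * b ^ K) (Q-1≡2G i) (Q+3≡2G+4 i) ⟨
        (Q i + -1ℤ) * (Q i + + 3) ^ K                   ∎
        where open ℤ.≤-Reasoning
      upper≈ : (λ i → (Q i + -1ℤ) * (Q i + + 3) ^ K) ≈[ K ] (λ i → Q i ^ suc K)
      upper≈ = begin
        (λ i → (Q i + -1ℤ) * (Q i + + 3) ^ K)              ≈⟨ ≈-reflexive (λ i → ℤ.*-distribʳ-+ _ (Q i) -1ℤ) ⟩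
        (λ i → Q i * (Q i + + 3) ^ K + -1ℤ * (Q i + + 3) ^ K) ≈⟨ ≈-+ (≈-*Q (binomial-leading (+ 3) k)) (≈-*ˡ -1ℤ (polynomial-O (+ 3) K)) ⟩
        (λ i → Q i ^ suc K + -1ℤ * 0ℤ)                      ≈⟨ ≈-reflexive (λ i → ℤ.+-identityʳ _) ⟩
        (λ i → Q i ^ suc K)                                 ∎
        where open ≈-Reasoning K

    2^k*S^k : ∀ i k → 2 ℕ.^ k ℕ.* #S i ℕ.^ k ≡ (q i ℕ.+ 1) ℕ.^ k
    2^k*S^k i@(F , odd) k = trans (sym (*-^-distrib 2 (#S i) k)) (cong (ℕ._^ k) (Squares.2*#squares F odd))

    4*#O-zero : ∀ i → + (4 ℕ.^ 1 ℕ.* #O 0 i) ≡ + 2 * Q i ^ 1 + + 2 * Q i ^ 0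
    4*#O-zero i@(F , odd) = begin
      + (4 ℕ.^ 1 ℕ.* #O 0 i)                ≡⟨ cong (λ o → + (4 ℕ.^ 1 ℕ.* o)) (KakeyaCount.#overlap-0 F odd) ⟩
      + (4 ℕ.* 1 ℕ.* #S i)                  ≡⟨ cong +_ (double (#S i)) ⟩
      + (2 ℕ.* (2 ℕ.* #S i))                ≡⟨ cong (λ n → + (2 ℕ.* n)) (Squares.2*#squares F odd) ⟩
      + (2 ℕ.* (q i ℕ.+ 1))                 ≡⟨ cong +_ (expand (q i)) ⟩
      + (2 ℕ.* (q i ℕ.* 1) ℕ.+ 2 ℕ.* 1)     ≡⟨ ℤ.pos-+ (2 ℕ.* (q i ℕ.* 1)) (2 ℕ.* 1) ⟩
      + (2 ℕ.* (q i ℕ.* 1)) + + (2 ℕ.* 1)   ≡⟨ cong₂ _+_ (trans (ℤ.pos-* 2 (q i ℕ.* 1)) (cong (+ 2 *_) (ℤ.pos-* (q i) 1))) (ℤ.pos-* 2 1) ⟩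
      + 2 * Q i ^ 1 + + 2 * Q i ^ 0         ∎
      where
      open ≡-Reasoning
      double : ∀ s → 4 ℕ.* 1 ℕ.* s ≡ 2 ℕ.* (2 ℕ.* s)
      double = ℕ-Solver.solve-∀
      expand : ∀ x → 2 ℕ.* (x ℕ.+ 1) ≡ 2 ℕ.* (x ℕ.* 1) ℕ.+ 2 ℕ.* 1
      expand = ℕ-Solver.solve-∀

    4^k*S^k : ∀ i k → 4 ℕ.^ k ℕ.* #S i ℕ.^ k ≡ 2 ℕ.^ k ℕ.* (q i ℕ.+ 1) ℕ.^ k
    4^k*S^k i k = begin
      4 ℕ.^ k ℕ.* #S i ℕ.^ k               ≡⟨ cong (ℕ._* #S i ℕ.^ k) (*-^-distrib 2 2 k) ⟩
      2 ℕ.^ k ℕ.* 2 ℕ.^ k ℕ.* #S i ℕ.^ k   ≡⟨ ℕ.*-assoc (2 ℕ.^ k) _ _ ⟩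
      2 ℕ.^ k ℕ.* (2 ℕ.^ k ℕ.* #S i ℕ.^ k) ≡⟨ cong (2 ℕ.^ k ℕ.*_) (2^k*S^k i k) ⟩
      2 ℕ.^ k ℕ.* (q i ℕ.+ 1) ℕ.^ k        ∎
      where open ≡-Reasoning

    4^k*#O-suc : ∀ k i → + (4 ℕ.^ suc (suc k) ℕ.* #O (suc k) i)
                     ≡ + (4 ℕ.* 2 ℕ.^ suc k) * (Q i + 1ℤ) ^ suc k + + 2 * + (2 ℕ.* (4 ℕ.^ suc k ℕ.* #O⁺ k i))
    4^k*#O-suc k i@(F , odd) = begin
      + (4 ℕ.^ suc K ℕ.* #O K i)
        ≡⟨ cong (λ o → + (4 ℕ.^ suc K ℕ.* o)) (KakeyaCount.#overlap-suc F odd k) ⟩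
      + (4 ℕ.^ suc K ℕ.* (#S i ℕ.^ K ℕ.+ #O⁺ k i))
        ≡⟨ cong +_ (split (4 ℕ.^ K) (#S i ℕ.^ K) (#O⁺ k i)) ⟩
      + (4 ℕ.* (4 ℕ.^ K ℕ.* #S i ℕ.^ K) ℕ.+ 2 ℕ.* (2 ℕ.* (4 ℕ.^ K ℕ.* #O⁺ k i)))
        ≡⟨ cong (λ x → + (4 ℕ.* x ℕ.+ 2 ℕ.* (2 ℕ.* (4 ℕ.^ K ℕ.* #O⁺ k i)))) (4^k*S^k i K) ⟩
      + (4 ℕ.* (2 ℕ.^ K ℕ.* (q i ℕ.+ 1) ℕ.^ K) ℕ.+ 2 ℕ.* (2 ℕ.* (4 ℕ.^ K ℕ.* #O⁺ k i)))
        ≡⟨ cong₂ _+_ (trans (cong +_ (sym (ℕ.*-assoc 4 (2 ℕ.^ K) _))) (trans (ℤ.pos-* (4 ℕ.* 2 ℕ.^ K) _) (cong (+ (4 ℕ.* 2 ℕ.^ K) *_) (pos-^ (q i ℕ.+ 1) K))))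
                     (ℤ.pos-* 2 (2 ℕ.* (4 ℕ.^ K ℕ.* #O⁺ k i))) ⟩
      + (4 ℕ.* 2 ℕ.^ K) * (Q i + 1ℤ) ^ K + + 2 * + (2 ℕ.* (4 ℕ.^ K ℕ.* #O⁺ k i)) ∎
      where
      open ≡-Reasoning
      K : ℕ
      K = suc k
      split : ∀ f s o → 4 ℕ.* f ℕ.* (s ℕ.+ o) ≡ 4 ℕ.* (f ℕ.* s) ℕ.+ 2 ℕ.* (2 ℕ.* (f ℕ.* o))
      split = ℕ-Solver.solve-∀

    overlap-≈ : ∀ k → (λ i → + (4 ℕ.^ suc k ℕ.* #O k i)) ≈[ k ] (λ i → + 2 * Q i ^ suc k)
    overlap-≈ zero = begin
      (λ i → + (4 ℕ.^ 1 ℕ.* #O 0 i))          ≈⟨ ≈-reflexive 4*#O-zero ⟩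
      (λ i → + 2 * Q i ^ 1 + + 2 * Q i ^ 0)   ≈⟨ ≈-+ˡ (λ i → + 2 * Q i ^ 1) (a*Q^k≈0 (+ 2) 0) ⟩
      (λ i → + 2 * Q i ^ 1 + 0ℤ)              ≈⟨ ≈-reflexive (λ i → ℤ.+-identityʳ _) ⟩
      (λ i → + 2 * Q i ^ 1)                   ∎
      where open ≈-Reasoning 0
    overlap-≈ (suc k) = begin
      (λ i → + (4 ℕ.^ suc K ℕ.* #O K i))
        ≈⟨ ≈-reflexive (4^k*#O-suc k) ⟩
      (λ i → + (4 ℕ.* 2 ℕ.^ K) * (Q i + 1ℤ) ^ K + + 2 * + (2 ℕ.* (4 ℕ.^ K ℕ.* #O⁺ k i)))
        ≈⟨ ≈-+ (≈-*ˡ (+ (4 ℕ.* 2 ℕ.^ K)) (polynomial-O 1ℤ K)) (≈-*ˡ (+ 2) (overlap⁺-≈ k)) ⟩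
      (λ i → + (4 ℕ.* 2 ℕ.^ K) * 0ℤ + + 2 * Q i ^ suc K)
        ≈⟨ ≈-reflexive (λ i → trans (cong (_+ + 2 * Q i ^ suc K) (ℤ.*-zeroʳ (+ (4 ℕ.* 2 ℕ.^ K)))) (ℤ.+-identityˡ (+ 2 * Q i ^ suc K))) ⟩
      (λ i → + 2 * Q i ^ suc K) ∎
      where
      K : ℕ
      K = suc k
      open ≈-Reasoning K

    #K-suc : ∀ m i → + #K (suc m) i ≡ Q i * + (#S i ℕ.^ suc m) + + #K m i - + #O m i
    #K-suc m i@(F , odd) = begin
      + #K (suc m) i                                    ≡⟨ add-sub (+ #K (suc m) i) (+ #O m i) ⟩
      + #K (suc m) i + + #O m i - + #O m i             ≡⟨ cong (λ n → + n - + #O m i) (KakeyaCount.#kakeya-suc F odd m) ⟩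
      + (q i ℕ.* #S i ℕ.^ suc m ℕ.+ #K m i) - + #O m i  ≡⟨ cong (λ n → n + + #K m i - + #O m i) (ℤ.pos-* (q i) _) ⟩
      Q i * + (#S i ℕ.^ suc m) + + #K m i - + #O m i    ∎
      where
      open ≡-Reasoning
      add-sub : ∀ x y → x ≡ x + y - y
      add-sub = solve-∀

    4^m*Q*#K-suc : ∀ m i → + (4 ℕ.^ suc m) * Q i * + #K (suc m) i
      ≡ + (2 ℕ.^ suc m) * (Q i * (Q i * (Q i + 1ℤ) ^ suc m)) + + 4 * (+ (4 ℕ.^ m) * Q i * + #K m i) - Q i * + (4 ℕ.^ suc m ℕ.* #O m i)
    4^m*Q*#K-suc m i = begin
      W * Q i * + #K (suc m) i
        ≡⟨ cong (W * Q i *_) (#K-suc m i) ⟩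
      W * Q i * (Q i * X + + #K m i - + #O m i)
        ≡⟨ distribute W (Q i) X (+ #K m i) (+ #O m i) ⟩
      W * (Q i * (Q i * X)) + W * Q i * + #K m i - Q i * (W * + #O m i)
        ≡⟨ cong₂ (λ a b → a + b - Q i * (W * + #O m i)) leading (cong (λ w → w * Q i * + #K m i) (ℤ.pos-* 4 (4 ℕ.^ m))) ⟩
      T * (Q i * (Q i * (Q i + 1ℤ) ^ suc m)) + + 4 * + (4 ℕ.^ m) * Q i * + #K m i - Q i * (W * + #O m i)
        ≡⟨ cong₂ (λ a b → T * (Q i * (Q i * (Q i + 1ℤ) ^ suc m)) + a - Q i * b) (reassoc (+ 4) (+ (4 ℕ.^ m)) (Q i) (+ #K m i)) (sym (ℤ.pos-* (4 ℕ.^ suc m) (#O m i))) ⟩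
      T * (Q i * (Q i * (Q i + 1ℤ) ^ suc m)) + + 4 * (+ (4 ℕ.^ m) * Q i * + #K m i) - Q i * + (4 ℕ.^ suc m ℕ.* #O m i) ∎
      where
      open ≡-Reasoning
      W T X : ℤ
      W = + (4 ℕ.^ suc m)
      T = + (2 ℕ.^ suc m)
      X = + (#S i ℕ.^ suc m)
      distribute : ∀ w q x k o → w * q * (q * x + k - o) ≡ w * (q * (q * x)) + w * q * k - q * (w * o)
      distribute = solve-∀
      reassoc : ∀ a b c d → a * b * c * d ≡ a * (b * c * d)
      reassoc = solve-∀
      swap : ∀ t q x → t * t * (q * (q * x)) ≡ t * (q * (q * (t * x)))
      swap = solve-∀
      W≡T*T : W ≡ T * T
      W≡T*T = trans (cong +_ (*-^-distrib 2 2 (suc m))) (ℤ.pos-* (2 ℕ.^ suc m) (2 ℕ.^ suc m))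
      T*X≡[Q+1]^m : T * X ≡ (Q i + 1ℤ) ^ suc m
      T*X≡[Q+1]^m = trans (sym (ℤ.pos-* (2 ℕ.^ suc m) _)) (trans (cong +_ (2^k*S^k i (suc m))) (pos-^ (q i ℕ.+ 1) (suc m)))
      leading : W * (Q i * (Q i * X)) ≡ T * (Q i * (Q i * (Q i + 1ℤ) ^ suc m))
      leading = trans (cong (_* (Q i * (Q i * X))) W≡T*T) (trans (swap T (Q i) X) (cong (λ y → T * (Q i * (Q i * y))) T*X≡[Q+1]^m))

    leadingTerms : ℕ → OddField → ℤ
    leadingTerms m i = + (2 ℕ.^ m) * Q i ^ suc (suc m) + (+ (2 ℕ.^ m) * + (2 ℕ.+ m) - + 2) * Q i ^ suc m

    leadingTerms-suc : ∀ m i →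
      + (2 ℕ.^ suc m) * (Q i * (Q i ^ suc (suc m) + + suc m * 1ℤ * Q i ^ suc m)) + + 4 * leadingTerms m i - Q i * (+ 2 * Q i ^ suc m)
      ≡ leadingTerms (suc m) i + + 4 * (+ (2 ℕ.^ m) * + (2 ℕ.+ m) - + 2) * Q i ^ suc m
    leadingTerms-suc m i =
      trans (cong (λ t → t * (Q i * (Q i ^ suc (suc m) + + suc m * 1ℤ * Q i ^ suc m)) + + 4 * leadingTerms m i - Q i * (+ 2 * Q i ^ suc m)) T≡2U)
        (trans (collect U (Q i) (Q i ^ suc m) (+ m))
          (cong (λ t → t * Q i ^ suc (suc (suc m)) + (t * + (3 ℕ.+ m) - + 2) * Q i ^ suc (suc m) + + 4 * (U * + (2 ℕ.+ m) - + 2) * Q i ^ suc m)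
                (sym T≡2U)))
      where
      U : ℤ
      U = + (2 ℕ.^ m)
      T≡2U : + (2 ℕ.^ suc m) ≡ + 2 * U
      T≡2U = ℤ.pos-* 2 (2 ℕ.^ m)
      collect : ∀ u x p k → + 2 * u * (x * (x * p + (+ 1 + k) * 1ℤ * p)) + + 4 * (u * (x * p) + (u * (+ 2 + k) - + 2) * p) - x * (+ 2 * p)
                          ≡ + 2 * u * (x * (x * p)) + (+ 2 * u * (+ 3 + k) - + 2) * (x * p) + + 4 * (u * (+ 2 + k) - + 2) * p
      collect = solve-∀

    kakeya-≈ : ∀ m → (λ i → + (4 ℕ.^ m) * Q i * + #K m i) ≈[ m ] leadingTerms m
    kakeya-≈ zero = ≈-reflexive exact
      where
      square : ∀ x → + 1 * x * x ≡ + 1 * (x * (x * + 1)) + (+ 1 * + 2 - + 2) * (x * + 1)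
      square = solve-∀
      exact : ∀ i → + 1 * Q i * + #K 0 i ≡ leadingTerms 0 i
      exact i@(F , odd) = trans (cong (λ n → + 1 * Q i * + n) (KakeyaCount.#kakeya-0 F odd)) (square (Q i))
    kakeya-≈ (suc m) = begin
      (λ i → + (4 ℕ.^ suc m) * Q i * + #K (suc m) i)
        ≈⟨ ≈-reflexive (4^m*Q*#K-suc m) ⟩
      (λ i → T * (Q i * (Q i * (Q i + 1ℤ) ^ suc m)) + + 4 * (+ (4 ℕ.^ m) * Q i * + #K m i) - Q i * + (4 ℕ.^ suc m ℕ.* #O m i))
        ≈⟨ ≈-− (≈-+ (≈-*ˡ T (≈-*Q (binomial-two-terms 1ℤ m))) (≈-*ˡ (+ 4) (≈-weaken (kakeya-≈ m)))) (≈-*Q (overlap-≈ m)) ⟩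
      (λ i → T * (Q i * (Q i ^ suc (suc m) + + suc m * 1ℤ * Q i ^ suc m)) + + 4 * leadingTerms m i - Q i * (+ 2 * Q i ^ suc m))
        ≈⟨ ≈-reflexive (leadingTerms-suc m) ⟩
      (λ i → leadingTerms (suc m) i + c * Q i ^ suc m)
        ≈⟨ ≈-+ˡ (leadingTerms (suc m)) (a*Q^k≈0 c (suc m)) ⟩
      (λ i → leadingTerms (suc m) i + 0ℤ)
        ≈⟨ ≈-reflexive (λ i → ℤ.+-identityʳ (leadingTerms (suc m) i)) ⟩
      leadingTerms (suc m) ∎
      where
      open ≈-Reasoning (suc m)
      T c : ℤ
      T = + (2 ℕ.^ suc m)
      c = + 4 * (+ (2 ℕ.^ m) * + (2 ℕ.+ m) - + 2)

    scaledCount-scaledMain : ∀ m i → + (4 ℕ.^ m) * Q i * + #K m i - leadingTerms m i ≡ + scaledCount m (#K m i) (q i) - + scaledMain m (q i)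
    scaledCount-scaledMain m i = trans (regroup (+ (4 ℕ.^ m)) (Q i) (+ #K m i) (+ (2 ℕ.^ m)) (+ (2 ℕ.+ m)) (Q i ^ suc m) (Q i ^ suc (suc m)))
      (sym (cong₂ _-_ count main))
      where
      regroup : ∀ f x c t k p₁ p₂ → f * x * c - (t * p₂ + (t * k - + 2) * p₁) ≡ (f * x * c + + 2 * p₁) - (t * p₂ + t * k * p₁)
      regroup = solve-∀
      count : + scaledCount m (#K m i) (q i) ≡ + (4 ℕ.^ m) * Q i * + #K m i + + 2 * Q i ^ suc m
      count = trans (ℤ.pos-+ (4 ℕ.^ m ℕ.* q i ℕ.* #K m i) _) (cong₂ _+_
        (trans (ℤ.pos-* (4 ℕ.^ m ℕ.* q i) (#K m i)) (cong (_* + #K m i) (ℤ.pos-* (4 ℕ.^ m) (q i))))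
        (trans (ℤ.pos-* 2 (q i ℕ.^ suc m)) (cong (+ 2 *_) (pos-^ (q i) (suc m)))))
      main : + scaledMain m (q i) ≡ + (2 ℕ.^ m) * Q i ^ suc (suc m) + + (2 ℕ.^ m) * + (2 ℕ.+ m) * Q i ^ suc m
      main = trans (ℤ.pos-+ (2 ℕ.^ m ℕ.* q i ℕ.^ suc (suc m)) _) (cong₂ _+_
        (trans (ℤ.pos-* (2 ℕ.^ m) _) (cong (+ (2 ℕ.^ m) *_) (pos-^ (q i) (suc (suc m)))))
        (trans (ℤ.pos-* (2 ℕ.^ m ℕ.* (2 ℕ.+ m)) _) (cong₂ _*_ (ℤ.pos-* (2 ℕ.^ m) (2 ℕ.+ m)) (pos-^ (q i) (suc m)))))

    #kakeya-bounds : ∀ m → ∃ λ D → ∀ i →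
      scaledCount m (#K m i) (q i) ℕ.≤ scaledMain m (q i) ℕ.+ D ℕ.* q i ℕ.^ m ×
      scaledMain m (q i) ℕ.≤ scaledCount m (#K m i) (q i) ℕ.+ D ℕ.* q i ℕ.^ m
    #kakeya-bounds m = D , λ i →
        ∣a-b∣≤e⇒a≤b+e (difference-bound i)
      , ∣a-b∣≤e⇒a≤b+e (subst (ℕ._≤ D ℕ.* q i ℕ.^ m) (ℤ.∣i-j∣≡∣j-i∣ (+ scaledCount m (#K m i) (q i)) (+ scaledMain m (q i))) (difference-bound i))
      where
      open _≈[_]_ (kakeya-≈ m) renaming (constant to D)
      difference-bound : ∀ i → ∣ + scaledCount m (#K m i) (q i) - + scaledMain m (q i) ∣ ℕ.≤ D ℕ.* q i ℕ.^ m
      difference-bound i = subst (λ z → ∣ z ∣ ℕ.≤ D ℕ.* q i ℕ.^ m) (scaledCount-scaledMain m i) (bound i)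

module _ where

  open import Data.Rational using (_+_; _*_; _-_; -_; ∣_∣; _≤_)
  open import Data.Integer using (+_)

  toℚᵘ-ℕtoℚ : ∀ a → ℚ.toℚᵘ (ℕtoℚ a) ℚᵘ.≃ mkℚᵘ (+ a) 0
  toℚᵘ-ℕtoℚ a = ℚ.toℚᵘ-fromℚᵘ (mkℚᵘ (+ a) 0)

  ℕtoℚ-+ : ∀ a b → ℕtoℚ (a ℕ.+ b) ≡ ℕtoℚ a + ℕtoℚ b
  ℕtoℚ-+ a b = ℚ.toℚᵘ-injective (ℚᵘ.≃-trans (toℚᵘ-ℕtoℚ (a ℕ.+ b)) (ℚᵘ.≃-trans homo-+
    (ℚᵘ.≃-sym (ℚᵘ.≃-trans (ℚ.toℚᵘ-homo-+ (ℕtoℚ a) (ℕtoℚ b)) (ℚᵘ.+-cong (toℚᵘ-ℕtoℚ a) (toℚᵘ-ℕtoℚ b))))))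
    where
    homo-+ : mkℚᵘ (+ (a ℕ.+ b)) 0 ℚᵘ.≃ mkℚᵘ (+ a) 0 ℚᵘ.+ mkℚᵘ (+ b) 0
    homo-+ = *≡* (trans (ℤ.*-identityʳ _) (trans (ℤ.pos-+ a b)
            (sym (trans (ℤ.*-identityʳ _) (cong₂ ℤ._+_ (ℤ.*-identityʳ (+ a)) (ℤ.*-identityʳ (+ b)))))))

  ℕtoℚ-* : ∀ a b → ℕtoℚ (a ℕ.* b) ≡ ℕtoℚ a * ℕtoℚ b
  ℕtoℚ-* a b = ℚ.toℚᵘ-injective (ℚᵘ.≃-trans (toℚᵘ-ℕtoℚ (a ℕ.* b)) (ℚᵘ.≃-trans homo-*
    (ℚᵘ.≃-sym (ℚᵘ.≃-trans (ℚ.toℚᵘ-homo-* (ℕtoℚ a) (ℕtoℚ b)) (ℚᵘ.*-cong (toℚᵘ-ℕtoℚ a) (toℚᵘ-ℕtoℚ b))))))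
    where
    homo-* : mkℚᵘ (+ (a ℕ.* b)) 0 ℚᵘ.≃ mkℚᵘ (+ a) 0 ℚᵘ.* mkℚᵘ (+ b) 0
    homo-* = *≡* (trans (ℤ.*-identityʳ _) (trans (ℤ.pos-* a b) (sym (ℤ.*-identityʳ _))))

  ℕtoℚ-mono-≤ : ∀ {a b} → a ℕ.≤ b → ℕtoℚ a ≤ ℕtoℚ b
  ℕtoℚ-mono-≤ {a} {b} a≤b = ℚ.toℚᵘ-cancel-≤ (ℚᵘ.≤-respʳ-≃ (ℚᵘ.≃-sym (toℚᵘ-ℕtoℚ b)) (ℚᵘ.≤-respˡ-≃ (ℚᵘ.≃-sym (toℚᵘ-ℕtoℚ a))
    (*≤* (subst₂ ℤ._≤_ (sym (ℤ.*-identityʳ (+ a))) (sym (ℤ.*-identityʳ (+ b))) (ℤ.+≤+ a≤b)))))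

  ℕtoℚ-*-invℕ : ∀ n .{{_ : NonZero n}} → ℕtoℚ n * invℕ n ≡ 1ℚ
  ℕtoℚ-*-invℕ (suc k) = ℚ.toℚᵘ-injective (ℚᵘ.≃-trans (ℚ.toℚᵘ-homo-* (ℕtoℚ (suc k)) (invℕ (suc k)))
    (ℚᵘ.≃-trans (ℚᵘ.*-cong (toℚᵘ-ℕtoℚ (suc k)) (ℚ.toℚᵘ-fromℚᵘ (mkℚᵘ (+ 1) k))) cancel))
    where
    cancel : mkℚᵘ (+ suc k) 0 ℚᵘ.* mkℚᵘ (+ 1) k ℚᵘ.≃ ℚ.toℚᵘ 1ℚ
    cancel = *≡* (cong (λ z → + suc z) (trans (ℕ.*-identityʳ (k ℕ.* 1)) (trans (ℕ.*-identityʳ k)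
               (sym (trans (ℕ.+-identityʳ (k ℕ.+ 0)) (ℕ.+-identityʳ k))))))

  0≤ℕtoℚ : ∀ a → 0ℚ ≤ ℕtoℚ a
  0≤ℕtoℚ a = ℕtoℚ-mono-≤ {0} {a} ℕ.z≤n

  0≤invℕ : ∀ n .{{_ : NonZero n}} → 0ℚ ≤ invℕ n
  0≤invℕ n = ℚ.nonNegative⁻¹ (invℕ n) {{ℚ.normalize-nonNeg 1 n}}

  ∣p-q∣≤r : ∀ {p q r} → p ≤ q + r → q ≤ p + r → ∣ p - q ∣ ≤ r
  ∣p-q∣≤r {p} {q} {r} p≤q+r q≤p+r with ℚ.∣p∣≡p∨∣p∣≡-p (p - q)
  ... | inj₁ ∣p-q∣≡p-q = ℚ.≤-trans (ℚ.≤-reflexive ∣p-q∣≡p-q) (ℚ.≤-trans (ℚ.+-monoˡ-≤ (- q) p≤q+r) (ℚ.≤-reflexive (cancel q r)))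
    where
    open +-*-Solver
    cancel : ∀ q r → q + r - q ≡ r
    cancel = solve 2 (λ q r → q :+ r :- q := r) refl
  ... | inj₂ ∣p-q∣≡q-p = ℚ.≤-trans (ℚ.≤-reflexive (trans ∣p-q∣≡q-p (flip p q))) (ℚ.≤-trans (ℚ.+-monoˡ-≤ (- p) q≤p+r) (ℚ.≤-reflexive (cancel p r)))
    where
    open +-*-Solver
    cancel : ∀ p r → p + r - p ≡ r
    cancel = solve 2 (λ p r → p :+ r :- p := r) refl
    flip : ∀ p q → - (p - q) ≡ q - p
    flip = solve 2 (λ p q → :- (p :- q) := q :- p) refl

  module _ (m c q : ℕ) .{{_ : NonZero q}} where

    private
      x y u v T P M C two : ℚ
      x = ℕtoℚ q
      y = invℕ q
      u = inv2^ m
      v = inv2^ (suc m)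
      T = ℕtoℚ (2 ℕ.^ m)
      P = ℕtoℚ (q ℕ.^ m)
      M = ℕtoℚ (2 ℕ.+ m)
      C = ℕtoℚ c
      two = ℕtoℚ 2

      x*y≡1 : x * y ≡ 1ℚ
      x*y≡1 = ℕtoℚ-*-invℕ q

      u*T≡1 : u * T ≡ 1ℚ
      u*T≡1 = trans (ℚ.*-comm u T) (ℕtoℚ-*-invℕ (2 ℕ.^ m) {{ℕ.m^n≢0 2 m}})

      0≤u : 0ℚ ≤ u
      0≤u = 0≤invℕ (2 ℕ.^ m) {{ℕ.m^n≢0 2 m}}

      0≤u*u*y : 0ℚ ≤ u * u * y
      0≤u*u*y = ℚ.nonNegative⁻¹ (u * u * y)
        {{ℚ.nonNeg*nonNeg⇒nonNeg (u * u) {{ℚ.nonNeg*nonNeg⇒nonNeg u {{u≥0}} u {{u≥0}}}} y {{ℚ.nonNegative (0≤invℕ q)}}}}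
        where
        u≥0 : ℚ.NonNegative u
        u≥0 = ℚ.nonNegative 0≤u

      u≤1 : u ≤ 1ℚ
      u≤1 = begin
        u       ≡⟨ ℚ.*-identityˡ u ⟨
        1ℚ * u  ≤⟨ ℚ.*-monoʳ-≤-nonNeg u {{ℚ.nonNegative 0≤u}} (ℕtoℚ-mono-≤ {1} (ℕ.m^n>0 2 m)) ⟩
        T * u   ≡⟨ trans (ℚ.*-comm T u) u*T≡1 ⟩
        1ℚ      ∎
        where open ℚ.≤-Reasoning

      u*u*y≤u*y : u * u * y ≤ u * y
      u*u*y≤u*y = ℚ.*-monoʳ-≤-nonNeg y {{ℚ.nonNegative (0≤invℕ q)}}
                    (ℚ.≤-trans (ℚ.*-monoˡ-≤-nonNeg u {{ℚ.nonNegative 0≤u}} u≤1) (ℚ.≤-reflexive (ℚ.*-identityʳ u)))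

      two*v≡u : two * v ≡ u
      two*v≡u = begin
        two * v                   ≡⟨ ℚ.*-identityʳ (two * v) ⟨
        two * v * 1ℚ              ≡⟨ cong (two * v *_) u*T≡1 ⟨
        two * v * (u * T)         ≡⟨ regroup two v u T ⟩
        two * T * v * u           ≡⟨ cong (λ z → z * v * u) (ℕtoℚ-* 2 (2 ℕ.^ m)) ⟨
        ℕtoℚ (2 ℕ.^ suc m) * v * u ≡⟨ cong (_* u) (ℕtoℚ-*-invℕ (2 ℕ.^ suc m) {{ℕ.m^n≢0 2 (suc m)}}) ⟩
        1ℚ * u                    ≡⟨ ℚ.*-identityˡ u ⟩
        u                         ∎
        where
        open ≡-Reasoning
        open +-*-Solver
        regroup : ∀ a b c d → a * b * (c * d) ≡ a * d * b * c
        regroup = solve 4 (λ a b c d → a :* b :* (c :* d) := a :* d :* b :* c) refl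

      scaledCount≡ : ℕtoℚ (scaledCount m c q) ≡ T * T * x * C + two * (x * P)
      scaledCount≡ = trans (ℕtoℚ-+ (4 ℕ.^ m ℕ.* q ℕ.* c) _) (cong₂ _+_
        (trans (ℕtoℚ-* (4 ℕ.^ m ℕ.* q) c) (cong (_* C) (trans (ℕtoℚ-* (4 ℕ.^ m) q)
          (cong (_* x) (trans (cong ℕtoℚ (*-^-distrib 2 2 m)) (ℕtoℚ-* (2 ℕ.^ m) (2 ℕ.^ m)))))))
        (trans (ℕtoℚ-* 2 (q ℕ.^ suc m)) (cong (two *_) (ℕtoℚ-* q (q ℕ.^ m)))))

      scaledMain≡ : ℕtoℚ (scaledMain m q) ≡ T * (x * (x * P)) + T * M * (x * P)
      scaledMain≡ = trans (ℕtoℚ-+ (2 ℕ.^ m ℕ.* q ℕ.^ suc (suc m)) _) (cong₂ _+_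
        (trans (ℕtoℚ-* (2 ℕ.^ m) _) (cong (T *_) (trans (ℕtoℚ-* q _) (cong (x *_) (ℕtoℚ-* q (q ℕ.^ m))))))
        (trans (ℕtoℚ-* (2 ℕ.^ m ℕ.* (2 ℕ.+ m)) _) (cong₂ _*_ (ℕtoℚ-* (2 ℕ.^ m) (2 ℕ.+ m)) (ℕtoℚ-* q (q ℕ.^ m)))))

    error-identity : ℕtoℚ c - mainTerm (suc m) q ≡ u * u * y * (ℕtoℚ (scaledCount m c q) - ℕtoℚ (scaledMain m q))
    error-identity = begin
      C - u * ℕtoℚ (q ℕ.^ suc m) * (1ℚ + (M - ℕtoℚ 4 * v) * y)
        ≡⟨ cong₂ (λ a b → C - u * a * (1ℚ + (M - b * v) * y)) (ℕtoℚ-* q (q ℕ.^ m)) (ℕtoℚ-* 2 2) ⟩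
      C - u * (x * P) * (1ℚ + (M - two * two * v) * y)
        ≡⟨ expand-main C u x P M two v y ⟩
      C - u * x * P - u * M * P * (x * y) + two * u * (two * v) * P * (x * y)
        ≡⟨ cong₂ (λ a b → C - u * x * P - u * M * P * a + two * u * b * P * a) x*y≡1 two*v≡u ⟩
      C - u * x * P - u * M * P * 1ℚ + two * u * u * P * 1ℚ
        ≡⟨ simplify C u x P M two ⟩
      1ℚ * 1ℚ * 1ℚ * C + two * u * u * 1ℚ * P - u * 1ℚ * x * 1ℚ * P - u * 1ℚ * M * 1ℚ * P
        ≡⟨ cong₂ (λ a b → a * a * b * C + two * u * u * b * P - u * a * x * b * P - u * a * M * b * P) u*T≡1 x*y≡1 ⟨
      (u * T) * (u * T) * (x * y) * C + two * u * u * (x * y) * P - u * (u * T) * x * (x * y) * P - u * (u * T) * M * (x * y) * P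
        ≡⟨ expand-difference C u x y T P M two ⟨
      u * u * y * ((T * T * x * C + two * (x * P)) - (T * (x * (x * P)) + T * M * (x * P)))
        ≡⟨ cong₂ (λ a b → u * u * y * (a - b)) scaledCount≡ scaledMain≡ ⟨
      u * u * y * (ℕtoℚ (scaledCount m c q) - ℕtoℚ (scaledMain m q)) ∎
      where
      open ≡-Reasoning
      open +-*-Solver
      expand-main : ∀ C u x P M two v y → C - u * (x * P) * (1ℚ + (M - two * two * v) * y)
                    ≡ C - u * x * P - u * M * P * (x * y) + two * u * (two * v) * P * (x * y)
      expand-main = solve 8 (λ C u x P M two v y → C :- u :* (x :* P) :* (con 1ℚ :+ (M :- two :* two :* v) :* y)
                              := C :- u :* x :* P :- u :* M :* P :* (x :* y) :+ two :* u :* (two :* v) :* P :* (x :* y)) refl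
      simplify : ∀ C u x P M two → C - u * x * P - u * M * P * 1ℚ + two * u * u * P * 1ℚ
                 ≡ 1ℚ * 1ℚ * 1ℚ * C + two * u * u * 1ℚ * P - u * 1ℚ * x * 1ℚ * P - u * 1ℚ * M * 1ℚ * P
      simplify = solve 6 (λ C u x P M two → C :- u :* x :* P :- u :* M :* P :* con 1ℚ :+ two :* u :* u :* P :* con 1ℚ
                           := con 1ℚ :* con 1ℚ :* con 1ℚ :* C :+ two :* u :* u :* con 1ℚ :* P :- u :* con 1ℚ :* x :* con 1ℚ :* P
                              :- u :* con 1ℚ :* M :* con 1ℚ :* P) refl
      expand-difference : ∀ C u x y T P M two → u * u * y * ((T * T * x * C + two * (x * P)) - (T * (x * (x * P)) + T * M * (x * P)))
                          ≡ (u * T) * (u * T) * (x * y) * C + two * u * u * (x * y) * P - u * (u * T) * x * (x * y) * P - u * (u * T) * M * (x * y) * P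
      expand-difference = solve 8 (λ C u x y T P M two →
        u :* u :* y :* ((T :* T :* x :* C :+ two :* (x :* P)) :- (T :* (x :* (x :* P)) :+ T :* M :* (x :* P)))
        := (u :* T) :* (u :* T) :* (x :* y) :* C :+ two :* u :* u :* (x :* y) :* P :- u :* (u :* T) :* x :* (x :* y) :* P
           :- u :* (u :* T) :* M :* (x :* y) :* P) refl

    error-bound : ∀ D → scaledCount m c q ℕ.≤ scaledMain m q ℕ.+ D ℕ.* q ℕ.^ m → scaledMain m q ℕ.≤ scaledCount m c q ℕ.+ D ℕ.* q ℕ.^ m →
                  ∣ ℕtoℚ c - mainTerm (suc m) q ∣ ≤ ℕtoℚ D * errTerm (suc m) q
    error-bound D count≤ main≤ = begin
      ∣ ℕtoℚ c - mainTerm (suc m) q ∣       ≡⟨ cong ∣_∣ error-identity ⟩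
      ∣ u * u * y * (a - b) ∣               ≡⟨ ℚ.∣p*q∣≡∣p∣*∣q∣ (u * u * y) (a - b) ⟩
      ∣ u * u * y ∣ * ∣ a - b ∣             ≡⟨ cong (_* ∣ a - b ∣) (ℚ.0≤p⇒∣p∣≡p 0≤u*u*y) ⟩
      u * u * y * ∣ a - b ∣                 ≤⟨ ℚ.*-monoˡ-≤-nonNeg (u * u * y) {{ℚ.nonNegative 0≤u*u*y}} (∣p-q∣≤r a≤b+e b≤a+e) ⟩
      u * u * y * e                         ≤⟨ ℚ.*-monoʳ-≤-nonNeg e {{ℚ.nonNegative 0≤e}} u*u*y≤u*y ⟩
      u * y * e                             ≡⟨ ℚ.*-identityʳ (u * y * e) ⟨
      u * y * e * 1ℚ                        ≡⟨ cong (u * y * e *_) x*y≡1 ⟨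
      u * y * e * (x * y)                   ≡⟨ cong (λ z → u * y * z * (x * y)) (ℕtoℚ-* D (q ℕ.^ m)) ⟩
      u * y * (ℕtoℚ D * P) * (x * y)        ≡⟨ regroup u y (ℕtoℚ D) P x ⟩
      ℕtoℚ D * (u * (x * P) * y * y)        ≡⟨ cong (λ z → ℕtoℚ D * (u * z * y * y)) (ℕtoℚ-* q (q ℕ.^ m)) ⟨
      ℕtoℚ D * errTerm (suc m) q            ∎
      where
      open ℚ.≤-Reasoning
      open +-*-Solver using (solve; _:*_; _:=_)
      a b e : ℚ
      a = ℕtoℚ (scaledCount m c q)
      b = ℕtoℚ (scaledMain m q)
      e = ℕtoℚ (D ℕ.* q ℕ.^ m)
      0≤e : 0ℚ ≤ e
      0≤e = 0≤ℕtoℚ (D ℕ.* q ℕ.^ m)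
      regroup : ∀ u y d p x → u * y * (d * p) * (x * y) ≡ d * (u * (x * p) * y * y)
      regroup = solve 5 (λ u y d p x → u :* y :* (d :* p) :* (x :* y) := d :* (u :* (x :* p) :* y :* y)) refl
      a≤b+e : a ≤ b + e
      a≤b+e = ℚ.≤-trans (ℕtoℚ-mono-≤ count≤) (ℚ.≤-reflexive (ℕtoℚ-+ (scaledMain m q) _))
      b≤a+e : b ≤ a + e
      b≤a+e = ℚ.≤-trans (ℕtoℚ-mono-≤ main≤) (ℚ.≤-reflexive (ℕtoℚ-+ (scaledCount m c q) _))

open import Data.Nat using (ℕ; _≤_)
open import Data.Rational using (ℚ; ∣_∣; _-_; _*_) renaming (_≤_ to _≤ℚ_)

proposition11 : ∀ (n : ℕ) → 1 ≤ n →
  ∃ λ (C : ℚ) →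
    ∀ (F : FiniteField) → (odd : ¬ (2 ∣ FiniteField.size F)) →
      ∃ λ (K : Point F n → Bool) →
        IsKakeya F n K ×
        (∣ ℕtoℚ (card F n K) - mainTerm n (FiniteField.size F) {{odd⇒nonZero _ odd}} ∣
           ≤ℚ C * errTerm n (FiniteField.size F) {{odd⇒nonZero _ odd}})
proposition11 (suc m) (s≤s z≤n) with KakeyaAsymptotics.#kakeya-bounds m
... | D , bounds = ℕtoℚ D , λ F odd →
  let count≤ , main≤ = bounds (F , odd) in
  KakeyaSet.kakeya F odd m , KakeyaSet.kakeya-isKakeya F odd m ,
  error-bound m (KakeyaCount.#kakeya F odd m) (FiniteField.size F) {{odd⇒nonZero _ odd}} D count≤ main≤
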